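{- Let $k$ be a non-negative integer, let $G$ be a graph, let $v$ be a vertex of $G$ and let $w\neq v$ be a twin of $v$ in $G$. If $G\setminus w\in\Delta_k$, then $G$ has a linear layout $L$ of width $k+1$ whose first vertex is $v$ and whose last vertex is $w$.
   Context: Graphs are finite and simple. A vertex $w$ is a twin of a vertex $v$ if no vertex other than $v$ and $w$ is adjacent to exactly one of $v$ and $w$; $v$ and $w$ may or may not be adjacent. $G\setminus w$ is $G$ with $w$ deleted. For $X\subseteq V(G)$, $\mathrm{cutrk}_G(X)$ is the binary rank of the submatrix of the adjacency matrix with rows $X$ and columns $V(G)\setminus X$. A linear layout of $G$ is an ordering $(v_1,\dots,v_n)$ of $V(G)$, with width $\max_i\mathrm{cutrk}_G(\{v_1,\dots,v_i\})$ (or $0$ if $n\le1$). A delta composition of $G_1,G_2,G_3$ is obtained from their disjoint union by choosing $v_i\in V(G_i)$ and adding the triangle $v_1v_2v_3$. $\Delta_0=\{K_2\}$, and for $i\ge1$, $\Delta_i$ is the set of delta compositions of three (not necessarily distinct) graphs in $\Delta_{i-1}$, up to isomorphism. -}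

module Defs where

open import Data.Nat using (ℕ; zero; suc; _+_; _≤_; _<ᵇ_)
open import Data.Bool using (Bool; true; false; _∧_; _xor_; not)
open import Data.Bool.Properties using (∧-comm)
open import Data.Fin using (Fin; zero; suc; toℕ; fromℕ; punchIn; splitAt; _≟_)
open import Data.Fin.Permutation using (Permutation; Permutation′; _⟨$⟩ʳ_; _⟨$⟩ˡ_)
open import Data.Sum using (_⊎_; inj₁; inj₂)
open import Data.Sum.Base as Sum using ()
open import Data.Product using (Σ; ∃; _×_; _,_)
open import Relation.Nullary.Decidable using (⌊_⌋)
open import Relation.Binary.PropositionalEquality using (_≡_; _≢_; refl)

record Graph (n : ℕ) : Set where
  field
    adj     : Fin n → Fin n → Bool
    sym     : ∀ x y → adj x y ≡ adj y x
    irrefl  : ∀ x → adj x x ≡ false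
open Graph public

Twin : ∀ {n} → Graph n → Fin n → Fin n → Set
Twin G v w = ∀ u → u ≢ v → u ≢ w → adj G u v ≡ adj G u w

delete : ∀ {n} → Graph (suc n) → Fin (suc n) → Graph n
delete G w = record
  { adj    = λ i j → adj G (punchIn w i) (punchIn w j)
  ; sym    = λ i j → sym G (punchIn w i) (punchIn w j)
  ; irrefl = λ i → irrefl G (punchIn w i)
  }

xorSum : ∀ {r} → (Fin r → Bool) → Bool
xorSum {zero}  f = false
xorSum {suc r} f = f zero xor xorSum (λ i → f (suc i))

-- g : Fin r → Fin n picks r rows (vertices) in X; they are linearly
-- independent over GF(2) as rows of the submatrix A[X , V \ X]
-- (columns restricted to vertices j with X j ≡ false).
IndepRows : ∀ {n r} → Graph n → (Fin n → Bool) → (Fin r → Fin n) → Set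
IndepRows {n} {r} G X g =
  (∀ i → X (g i) ≡ true) ×
  (∀ (c : Fin r → Bool) →
     (∀ j → X j ≡ false → xorSum (λ i → c i ∧ adj G (g i) j) ≡ false) →
     ∀ i → c i ≡ false)

-- CutRank G X r : cutrk_G(X) = r, i.e. r is the GF(2)-rank (maximum number
-- of linearly independent rows) of the submatrix with rows X, columns V \ X.
CutRank : ∀ {n} → Graph n → (Fin n → Bool) → ℕ → Set
CutRank {n} G X r =
  Σ (Fin r → Fin n) (IndepRows G X) ×
  (∀ r' (g : Fin r' → Fin n) → IndepRows G X g → r' ≤ r)

-- Linear layouts: L ⟨$⟩ʳ p is the vertex in position p (0-based),
-- so the layout is (L⟨$⟩ʳ0, ..., L⟨$⟩ʳ(n-1)).

Layout : ℕ → Set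
Layout n = Permutation′ n

prefix : ∀ {n} → Layout n → ℕ → Fin n → Bool
prefix L i x = toℕ (L ⟨$⟩ˡ x) <ᵇ i

-- width of L is w : w is the maximum over i = 0..n of cutrk(prefix i)
-- (i = 0 and i = n give cut-rank 0, so this is the paper's max over
--  i = 1..n, and it is 0 when n ≤ 1)
HasWidth : ∀ {n} → Graph n → Layout n → ℕ → Set
HasWidth {n} G L w =
  (Σ (Fin (suc n)) λ i → CutRank G (prefix L (toℕ i)) w) ×
  (∀ (i : Fin (suc n)) r → CutRank G (prefix L (toℕ i)) r → r ≤ w)

firstV : ∀ {n} → Layout (suc n) → Fin (suc n)
firstV L = L ⟨$⟩ʳ zero

lastV : ∀ {n} → Layout (suc n) → Fin (suc n)
lastV {n} L = L ⟨$⟩ʳ fromℕ n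

Iso : ∀ {n m} → Graph n → Graph m → Set
Iso {n} {m} G H =
  Σ (Permutation n m) λ π → ∀ x y → adj H (π ⟨$⟩ʳ x) (π ⟨$⟩ʳ y) ≡ adj G x y

K2 : Graph 2
K2 = record
  { adj    = λ x y → not ⌊ x ≟ y ⌋
  ; sym    = symK
  ; irrefl = irrK
  }
  where
  symK : ∀ (x y : Fin 2) → not ⌊ x ≟ y ⌋ ≡ not ⌊ y ≟ x ⌋
  symK zero zero = refl
  symK zero (suc zero) = refl
  symK (suc zero) zero = refl
  symK (suc zero) (suc zero) = refl
  irrK : ∀ (x : Fin 2) → not ⌊ x ≟ x ⌋ ≡ false
  irrK zero = refl
  irrK (suc zero) = refl

module DeltaComp {n₁ n₂ n₃ : ℕ} (G₁ : Graph n₁) (G₂ : Graph n₂) (G₃ : Graph n₃)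
                 (v₁ : Fin n₁) (v₂ : Fin n₂) (v₃ : Fin n₃) where

  Part : Set
  Part = Fin n₁ ⊎ (Fin n₂ ⊎ Fin n₃)

  loc : Fin (n₁ + (n₂ + n₃)) → Part
  loc x = Sum.map₂ (splitAt n₂) (splitAt n₁ x)

  chosen : Part → Bool
  chosen (inj₁ a)        = ⌊ a ≟ v₁ ⌋
  chosen (inj₂ (inj₁ b)) = ⌊ b ≟ v₂ ⌋
  chosen (inj₂ (inj₂ c)) = ⌊ c ≟ v₃ ⌋

  -- same part: adjacency of that G_i; different parts: adjacent iff both
  -- are the chosen vertices (the triangle v₁v₂v₃)
  adjP : Part → Part → Bool
  adjP (inj₁ a)        (inj₁ a')        = adj G₁ a a'
  adjP (inj₂ (inj₁ b)) (inj₂ (inj₁ b')) = adj G₂ b b'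
  adjP (inj₂ (inj₂ c)) (inj₂ (inj₂ c')) = adj G₃ c c'
  adjP x               y                = chosen x ∧ chosen y

  symP : ∀ x y → adjP x y ≡ adjP y x
  symP (inj₁ a)        (inj₁ a')        = sym G₁ a a'
  symP (inj₁ a)        (inj₂ (inj₁ b))  = ∧-comm ⌊ a ≟ v₁ ⌋ ⌊ b ≟ v₂ ⌋
  symP (inj₁ a)        (inj₂ (inj₂ c))  = ∧-comm ⌊ a ≟ v₁ ⌋ ⌊ c ≟ v₃ ⌋
  symP (inj₂ (inj₁ b)) (inj₁ a)         = ∧-comm ⌊ b ≟ v₂ ⌋ ⌊ a ≟ v₁ ⌋
  symP (inj₂ (inj₁ b)) (inj₂ (inj₁ b')) = sym G₂ b b'
  symP (inj₂ (inj₁ b)) (inj₂ (inj₂ c))  = ∧-comm ⌊ b ≟ v₂ ⌋ ⌊ c ≟ v₃ ⌋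
  symP (inj₂ (inj₂ c)) (inj₁ a)         = ∧-comm ⌊ c ≟ v₃ ⌋ ⌊ a ≟ v₁ ⌋
  symP (inj₂ (inj₂ c)) (inj₂ (inj₁ b))  = ∧-comm ⌊ c ≟ v₃ ⌋ ⌊ b ≟ v₂ ⌋
  symP (inj₂ (inj₂ c)) (inj₂ (inj₂ c')) = sym G₃ c c'

  irrP : ∀ x → adjP x x ≡ false
  irrP (inj₁ a)        = irrefl G₁ a
  irrP (inj₂ (inj₁ b)) = irrefl G₂ b
  irrP (inj₂ (inj₂ c)) = irrefl G₃ c

  graph : Graph (n₁ + (n₂ + n₃))
  graph = record
    { adj    = λ x y → adjP (loc x) (loc y)
    ; sym    = λ x y → symP (loc x) (loc y)
    ; irrefl = λ x → irrP (loc x)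
    }

deltaComp : ∀ {n₁ n₂ n₃} → Graph n₁ → Graph n₂ → Graph n₃ →
            Fin n₁ → Fin n₂ → Fin n₃ → Graph (n₁ + (n₂ + n₃))
deltaComp G₁ G₂ G₃ v₁ v₂ v₃ = DeltaComp.graph G₁ G₂ G₃ v₁ v₂ v₃

data InΔ : ℕ → ∀ {n} → Graph n → Set where
  base : ∀ {n} {G : Graph n} → Iso K2 G → InΔ 0 G
  step : ∀ {k n₁ n₂ n₃ n} {G₁ : Graph n₁} {G₂ : Graph n₂} {G₃ : Graph n₃} {G : Graph n} →
         InΔ k G₁ → InΔ k G₂ → InΔ k G₃ →
         (v₁ : Fin n₁) (v₂ : Fin n₂) (v₃ : Fin n₃) →
         Iso (deltaComp G₁ G₂ G₃ v₁ v₂ v₃) G → InΔ (suc k) G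

-- By induction over Δ_k, every vertex v of a graph in Δ_k starts a layout of width
-- exactly k + 1 which stays within width k + 1 after appending a twin of v, adjacent to v
-- or not; the theorem is this statement for G \ w with w appended. For a delta composition
-- of H₁, H₂, H₃ glued at t₁, t₂, t₃ and a in H₁, lay out a, then the layout of H₃ from t₃
-- reversed, then the rest of the layout of H₁ from a, then the layout of H₂ from t₂. A cut
-- of this layout is essentially a cut of a single Hᵢ, and the triangle adds at most one to
-- its rank: the row of a, of t₃, or the column of the twin. Reversing a unitriangular
-- submatrix of H₃ and adding the edge from a to a neighbour shows that width k + 2 is
-- attained. Ranks are over GF(2): upper bounds are certified by factorisations and lower
-- bounds by unitriangular submatrices.

module Submission where

open import Algebra.Bundles using (CommutativeRing)
open import Data.Bool using (Bool; true; false; not; _∧_; _xor_; if_then_else_)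
open import Data.Bool.Properties
  using (T-≡; not-involutive; xor-same; xor-identityʳ; xor-∧-commutativeRing;
         ∧-distribˡ-xor; ∧-distribʳ-xor; ∧-comm; ∧-assoc; ∧-zeroʳ; ∧-identityʳ)
open import Data.Fin
  using (Fin; zero; suc; toℕ; cast; fromℕ; fromℕ<; punchIn; punchOut; opposite;
         funToFin; finToFun; combine; _↑ˡ_; _↑ʳ_; join; splitAt)
import Data.Fin as Fin
open import Data.Fin.Permutation using (permutation; _⟨$⟩ʳ_; _⟨$⟩ˡ_; inverseˡ; inverseʳ)
open import Data.Fin.Properties
  using (toℕ-fromℕ; toℕ-fromℕ<; toℕ-cast; cast-involutive; toℕ<n; injective⇒≤; opposite-prop; 2↔Bool;
         punchIn-punchOut; punchOut-punchIn; punchOut-cong; punchInᵢ≢i; punchIn-injective;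
         splitAt-↑ˡ; splitAt-↑ʳ; join-splitAt; finToFun-funToFin; funToFin-finToFin)
open import Data.Nat using (ℕ; zero; suc; pred; _+_; _^_; _≤_; _<_; _<ᵇ_; z≤n; s≤s)
open import Data.Nat.Properties
  using (+-comm; suc-injective; ^-monoʳ-<; ≰⇒>; <⇒≱; ≮⇒≥; _≤?_; ∸-monoʳ-<; ≤-antisym; <ᵇ⇒<; <⇒<ᵇ; m≤m+n)
open import Data.Maybe using (Maybe; just; nothing)
open import Data.Maybe.Properties using (just-injective)
import Data.Maybe as Maybe
open import Data.List using (List; []; _∷_; _++_; map; reverse; [_]; take; drop; length; lookup)
open import Data.List.Properties
  using (∷-injective; ++-assoc; ++-conicalʳ; length-++; map-++; map-∘; take++drop≡id;
         reverse-++; reverse-involutive; unfold-reverse)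
open import Data.List.Membership.Propositional using (_∈_; _∉_)
open import Data.List.Membership.Propositional.Properties
  using (∈-++⁺ˡ; ∈-++⁺ʳ; ∈-++⁻; ∈-map⁺; ∈-map⁻; ∈-lookup)
open import Data.List.Relation.Binary.Disjoint.Propositional using (Disjoint)
open import Data.List.Relation.Unary.All.Properties using (¬Any⇒All¬)
open import Data.List.Relation.Unary.AllPairs using (_∷_)
open import Data.List.Relation.Unary.Any using (here; there; index)
open import Data.List.Relation.Unary.Any.Properties using (lookup-index)
  renaming (reverse⁺ to ∈-reverse⁺; reverse⁻ to ∈-reverse⁻)
open import Data.List.Relation.Unary.Unique.Propositional using (Unique; [])
open import Data.List.Relation.Unary.Unique.Propositional.Properties
  using (++⁺; map⁺; Unique[x∷xs]⇒x∉xs)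
open import Data.Product using (Σ; ∃; ∃₂; _×_; _,_)
open import Data.Sum using (_⊎_; inj₁; inj₂; [_,_]′)
import Data.Sum as Sum
open import Function using (_∘_; Inverse; Equivalence)
open import Relation.Binary.PropositionalEquality hiding ([_])
open import Relation.Binary.Definitions using (DecidableEquality)
open import Relation.Nullary using (yes; no)
open import Relation.Nullary.Decidable using (⌊_⌋; map′; isYes≗does; dec-true; dec-false)
open import Relation.Nullary.Negation using (contradiction)

open import Defs hiding (adj; sym; irrefl)

open import Algebra.Properties.CommutativeSemigroup
  (CommutativeRing.+-commutativeSemigroup xor-∧-commutativeRing) using (interchange)

private
  variable
    r r′ : ℕ
    Y A B : Set

-- Linear algebra over GF(2)

xorSum-cong : {f g : Fin r → Bool} → (∀ i → f i ≡ g i) → xorSum f ≡ xorSum g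
xorSum-cong {zero}  e = refl
xorSum-cong {suc r} e = cong₂ _xor_ (e zero) (xorSum-cong (e ∘ suc))

xorSum-false : {f : Fin r → Bool} → (∀ i → f i ≡ false) → xorSum f ≡ false
xorSum-false {zero}  e = refl
xorSum-false {suc r} e = cong₂ _xor_ (e zero) (xorSum-false (e ∘ suc))

xorSum-xor : (f g : Fin r → Bool) → xorSum (λ i → f i xor g i) ≡ xorSum f xor xorSum g
xorSum-xor {zero}  f g = refl
xorSum-xor {suc r} f g = trans (cong ((f zero xor g zero) xor_) (xorSum-xor (f ∘ suc) (g ∘ suc)))
                               (interchange (f zero) (g zero) _ _)

∧-distribˡ-xorSum : ∀ a (f : Fin r → Bool) → a ∧ xorSum f ≡ xorSum (λ i → a ∧ f i)
∧-distribˡ-xorSum {zero}  a f = ∧-zeroʳ a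
∧-distribˡ-xorSum {suc r} a f =
  trans (∧-distribˡ-xor a (f zero) _) (cong ((a ∧ f zero) xor_) (∧-distribˡ-xorSum a (f ∘ suc)))

∧-distribʳ-xorSum : ∀ a (f : Fin r → Bool) → xorSum f ∧ a ≡ xorSum (λ i → f i ∧ a)
∧-distribʳ-xorSum a f =
  trans (∧-comm _ a) (trans (∧-distribˡ-xorSum a f) (xorSum-cong (λ i → ∧-comm a (f i))))

xorSum-comm : (f : Fin r → Fin r′ → Bool) →
  xorSum (λ i → xorSum (f i)) ≡ xorSum (λ j → xorSum (λ i → f i j))
xorSum-comm {zero} {r′} f = sym (xorSum-false {r′} (λ _ → refl))
xorSum-comm {suc r} f = trans (cong (xorSum (f zero) xor_) (xorSum-comm (f ∘ suc)))
                              (sym (xorSum-xor (f zero) _))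

LinearlyIndependent : (Q : Y → Set) → (Fin r → Y → Bool) → Set
LinearlyIndependent {r = r} Q R =
  ∀ (c : Fin r → Bool) → (∀ y → Q y → xorSum (λ i → c i ∧ R i y) ≡ false) → ∀ i → c i ≡ false

unitriangular⇒independent : (Q : Y → Set) (R : Fin r → Y → Bool) (col : Fin r → Y) →
  (∀ i → Q (col i)) → (∀ i → R i (col i) ≡ true) → (∀ i j → toℕ j < toℕ i → R i (col j) ≡ false) →
  LinearlyIndependent Q R
unitriangular⇒independent {r = suc r} Q R col col∈Q diagonal below c c·R≡0 = coefficient
  where
  c₀≡0 : c zero ≡ false
  c₀≡0 = begin
    c zero                                                   ≡⟨ sym (∧-identityʳ _) ⟩
    c zero ∧ true                                            ≡⟨ cong (c zero ∧_) (sym (diagonal zero)) ⟩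
    c zero ∧ R zero (col zero)                               ≡⟨ sym (xor-identityʳ _) ⟩
    c zero ∧ R zero (col zero) xor false                     ≡⟨ cong ((c zero ∧ R zero (col zero)) xor_)
                                                                  (sym (xorSum-false λ i →
                                                                    trans (cong (c (suc i) ∧_) (below (suc i) zero (s≤s z≤n)))
                                                                          (∧-zeroʳ _))) ⟩
    xorSum (λ i → c i ∧ R i (col zero))                      ≡⟨ c·R≡0 (col zero) (col∈Q zero) ⟩
    false                                                    ∎
    where open ≡-Reasoning
  cₛ≡0 : ∀ i → c (suc i) ≡ false
  cₛ≡0 = unitriangular⇒independent Q (R ∘ suc) (col ∘ suc) (col∈Q ∘ suc) (diagonal ∘ suc)
           (λ i j j<i → below (suc i) (suc j) (s≤s j<i)) (c ∘ suc)
           (λ y q → trans (cong (λ b → (b ∧ R zero y) xor xorSum (λ i → c (suc i) ∧ R (suc i) y)) (sym c₀≡0)) (c·R≡0 y q))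
  coefficient : ∀ i → c i ≡ false
  coefficient zero    = c₀≡0
  coefficient (suc i) = cₛ≡0 i

funToFin-cong : ∀ {m} {f g : Fin r → Fin m} → (∀ i → f i ≡ g i) → funToFin f ≡ funToFin g
funToFin-cong {zero}  e = refl
funToFin-cong {suc r} e = cong₂ combine (e zero) (funToFin-cong (e ∘ suc))

-- Counting: such a map induces an injection Fin (2 ^ r′) → Fin (2 ^ r).
vector-injection⇒≤ : (Φ : (Fin r′ → Bool) → Fin r → Bool) →
  (∀ c c′ → (∀ i → Φ c i ≡ Φ c′ i) → ∀ j → c j ≡ c′ j) → r′ ≤ r
vector-injection⇒≤ {r′ = r′} {r = r} Φ Φ-injective with r′ ≤? r
... | yes r′≤r = r′≤r
... | no  r′≰r = contradiction (injective⇒≤ encode-injective) (<⇒≱ (^-monoʳ-< 2 (s≤s (s≤s z≤n)) (≰⇒> r′≰r)))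
  where
  open Inverse 2↔Bool using (to; from; strictlyInverseˡ; strictlyInverseʳ)

  decode : Fin (2 ^ r′) → Fin r′ → Bool
  decode x = to ∘ finToFun x

  encode : Fin (2 ^ r′) → Fin (2 ^ r)
  encode x = funToFin (from ∘ Φ (decode x))

  encode-injective : ∀ {x y} → encode x ≡ encode y → x ≡ y
  encode-injective {x} {y} e = begin
    x                              ≡⟨ sym (funToFin-finToFin {r′} {2} x) ⟩
    funToFin (finToFun {2} {r′} x) ≡⟨ funToFin-cong same-digits ⟩
    funToFin (finToFun {2} {r′} y) ≡⟨ funToFin-finToFin {r′} {2} y ⟩
    y                              ∎
    where
    open ≡-Reasoning
    same-image : ∀ i → Φ (decode x) i ≡ Φ (decode y) i
    same-image i = begin
      Φ (decode x) i              ≡⟨ sym (strictlyInverseˡ _) ⟩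
      to (from (Φ (decode x) i))  ≡⟨ cong to (sym (finToFun-funToFin _ i)) ⟩
      to (finToFun (encode x) i)  ≡⟨ cong (λ z → to (finToFun z i)) e ⟩
      to (finToFun (encode y) i)  ≡⟨ cong to (finToFun-funToFin _ i) ⟩
      to (from (Φ (decode y) i))  ≡⟨ strictlyInverseˡ _ ⟩
      Φ (decode y) i              ∎
    same-digits : ∀ j → finToFun x j ≡ finToFun y j
    same-digits j = trans (sym (strictlyInverseʳ _))
      (trans (cong from (Φ-injective (decode x) (decode y) same-image j)) (strictlyInverseʳ _))

-- c ↦ c C is injective because c R = (c C) B and the rows of R are independent.
independent⇒≤ : (Q : Y → Set) (R : Fin r′ → Y → Bool) (C : Fin r′ → Fin r → Bool) (B : Fin r → Y → Bool) →
  (∀ j y → Q y → R j y ≡ xorSum (λ i → C j i ∧ B i y)) → LinearlyIndependent Q R → r′ ≤ r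
independent⇒≤ Q R C B R≡C·B independent = vector-injection⇒≤ combination combination-injective
  where
  combination : (Fin _ → Bool) → Fin _ → Bool
  combination c i = xorSum (λ j → c j ∧ C j i)

  R-combination : ∀ c y → Q y → xorSum (λ j → c j ∧ R j y) ≡ xorSum (λ i → combination c i ∧ B i y)
  R-combination c y q = begin
    xorSum (λ j → c j ∧ R j y)                          ≡⟨ xorSum-cong (λ j → cong (c j ∧_) (R≡C·B j y q)) ⟩
    xorSum (λ j → c j ∧ xorSum (λ i → C j i ∧ B i y))   ≡⟨ xorSum-cong (λ j → ∧-distribˡ-xorSum (c j) (λ i → C j i ∧ B i y)) ⟩
    xorSum (λ j → xorSum (λ i → c j ∧ (C j i ∧ B i y))) ≡⟨ xorSum-comm (λ j i → c j ∧ (C j i ∧ B i y)) ⟩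
    xorSum (λ i → xorSum (λ j → c j ∧ (C j i ∧ B i y))) ≡⟨ xorSum-cong (λ i → xorSum-cong (λ j → sym (∧-assoc (c j) (C j i) (B i y)))) ⟩
    xorSum (λ i → xorSum (λ j → (c j ∧ C j i) ∧ B i y)) ≡⟨ xorSum-cong (λ i → sym (∧-distribʳ-xorSum (B i y) (λ j → c j ∧ C j i))) ⟩
    xorSum (λ i → combination c i ∧ B i y)              ∎
    where open ≡-Reasoning

  combination-xor : ∀ c c′ i → combination (λ j → c j xor c′ j) i ≡ combination c i xor combination c′ i
  combination-xor c c′ i = trans (xorSum-cong (λ j → ∧-distribʳ-xor (C j i) (c j) (c′ j)))
                                 (xorSum-xor (λ j → c j ∧ C j i) (λ j → c′ j ∧ C j i))

  combination-injective : ∀ c c′ → (∀ i → combination c i ≡ combination c′ i) → ∀ j → c j ≡ c′ j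
  combination-injective c c′ e j = xor≡false (independent (λ j → c j xor c′ j) difference-vanishes j)
    where
    xor≡false : ∀ {a b} → a xor b ≡ false → a ≡ b
    xor≡false {false} {false} _ = refl
    xor≡false {true}  {true}  _ = refl
    difference-vanishes : ∀ y → Q y → xorSum (λ j → (c j xor c′ j) ∧ R j y) ≡ false
    difference-vanishes y q = trans (R-combination _ y q) (xorSum-false λ i → cong (_∧ B i y)
      (trans (combination-xor c c′ i) (trans (cong (combination c i xor_) (sym (e i))) (xor-same (combination c i)))))

-- Lists

++≡∷⁻ : ∀ (P : List A) {Q x xs} → P ++ Q ≡ x ∷ xs →
  (P ≡ [] × Q ≡ x ∷ xs) ⊎ ∃ λ P′ → P ≡ x ∷ P′ × P′ ++ Q ≡ xs
++≡∷⁻ []      e    = inj₁ (refl , e)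
++≡∷⁻ (p ∷ P) refl = inj₂ (P , refl , refl)

++≡++⁻ : ∀ (P : List A) {Q} xs {ys} → P ++ Q ≡ xs ++ ys →
  (∃ λ Q′ → P ++ Q′ ≡ xs × Q ≡ Q′ ++ ys) ⊎
  (∃₂ λ z zs → P ≡ xs ++ z ∷ zs × z ∷ zs ++ Q ≡ ys)
++≡++⁻ []      []       e    = inj₁ ([] , refl , e)
++≡++⁻ []      (x ∷ xs) e    = inj₁ (x ∷ xs , refl , e)
++≡++⁻ (p ∷ P) []       e    = inj₂ (p , P , refl , e)
++≡++⁻ (p ∷ P) (x ∷ xs) e with refl , e′ ← ∷-injective e with ++≡++⁻ P xs e′
... | inj₁ (Q′ , e₁ , e₂)     = inj₁ (Q′ , cong (p ∷_) e₁ , e₂)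
... | inj₂ (z , zs , e₁ , e₂) = inj₂ (z , zs , cong (p ∷_) e₁ , e₂)

++≡map⁻ : ∀ (f : A → B) (P : List B) {Q} xs → P ++ Q ≡ map f xs →
  ∃₂ λ xs₁ xs₂ → xs₁ ++ xs₂ ≡ xs × P ≡ map f xs₁ × Q ≡ map f xs₂
++≡map⁻ f []      xs       e = [] , xs , refl , refl , e
++≡map⁻ f (p ∷ P) (x ∷ xs) e with refl , e′ ← ∷-injective e with ++≡map⁻ f P xs e′
... | xs₁ , xs₂ , e₁ , e₂ , e₃ = x ∷ xs₁ , xs₂ , cong (x ∷_) e₁ , cong (f x ∷_) e₂ , e₃

++≡reverse⁻ : ∀ (P Q xs : List A) → P ++ Q ≡ reverse xs → reverse Q ++ reverse P ≡ xs
++≡reverse⁻ P Q xs e = trans (sym (reverse-++ P Q)) (trans (cong reverse e) (reverse-involutive xs))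

∈-map⁻-injective : ∀ (f : A → B) → (∀ {x y} → f x ≡ f y → x ≡ y) → ∀ {x xs} → f x ∈ map f xs → x ∈ xs
∈-map⁻-injective f f-injective x∈ with z , z∈ , e ← ∈-map⁻ f x∈ = subst (_∈ _) (sym (f-injective e)) z∈

∉-map : ∀ (f : A → B) {y} → (∀ z → f z ≢ y) → ∀ {xs} → y ∉ map f xs
∉-map f f≢y y∈ with z , _ , e ← ∈-map⁻ f y∈ = f≢y z (sym e)

unique-∷ : ∀ {x} {xs : List A} → x ∉ xs → Unique xs → Unique (x ∷ xs)
unique-∷ {xs = xs} x∉ u = ¬Any⇒All¬ xs x∉ ∷ u

unique-tail : ∀ {x} {xs : List A} → Unique (x ∷ xs) → Unique xs
unique-tail (_ ∷ u) = u

unique-++⇒disjoint : ∀ (xs : List A) {ys} → Unique (xs ++ ys) → Disjoint xs ys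
unique-++⇒disjoint (x ∷ xs) u (here refl , y∈) = Unique[x∷xs]⇒x∉xs u (∈-++⁺ʳ xs y∈)
unique-++⇒disjoint (x ∷ xs) u (there x∈ , y∈) = unique-++⇒disjoint xs (unique-tail u) (x∈ , y∈)

unique-reverse : ∀ {xs : List A} → Unique xs → Unique (reverse xs)
unique-reverse {xs = []}     u = []
unique-reverse {xs = x ∷ xs} u rewrite unfold-reverse x xs =
  ++⁺ (unique-reverse (unique-tail u)) (unique-∷ (λ ()) [])
      (λ { (x∈ , here refl) → Unique[x∷xs]⇒x∉xs u (∈-reverse⁻ x∈) })

lookup-injective : ∀ {xs : List A} → Unique xs → ∀ i j → lookup xs i ≡ lookup xs j → i ≡ j
lookup-injective {xs = _ ∷ _} u       zero    zero    e = refl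
lookup-injective {xs = _ ∷ _} u       zero    (suc j) e = contradiction (subst (_∈ _) (sym e) (∈-lookup j)) (Unique[x∷xs]⇒x∉xs u)
lookup-injective {xs = _ ∷ _} u       (suc i) zero    e = contradiction (subst (_∈ _) e (∈-lookup i)) (Unique[x∷xs]⇒x∉xs u)
lookup-injective {xs = _ ∷ _} (_ ∷ u) (suc i) (suc j) e = cong suc (lookup-injective u i j e)

map-++-∷ʳ : ∀ (f : A → B) {P Q ℓ} y → P ++ Q ≡ ℓ → map f P ++ (map f Q ++ [ y ]) ≡ map f ℓ ++ [ y ]
map-++-∷ʳ f {P} {Q} y P++Q≡ℓ =
  trans (sym (++-assoc (map f P) (map f Q) [ y ])) (cong (_++ [ y ]) (trans (sym (map-++ f P Q)) (cong (map f) P++Q≡ℓ)))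

just∈⁻ : ∀ {x : A} xs → just x ∈ map just xs ++ [ nothing ] → x ∈ xs
just∈⁻ xs x∈ with ∈-++⁻ (map just xs) x∈
... | inj₁ x∈′       = ∈-map⁻-injective just just-injective x∈′
... | inj₂ (here ())

disjoint-map : ∀ {C : Set} (f : A → C) (g : B → C) → (∀ x y → f x ≢ g y) → ∀ {xs ys} → Disjoint (map f xs) (map g ys)
disjoint-map f g f≢g (fx∈ , gy∈) with x , _ , refl ← ∈-map⁻ f fx∈ = ∉-map g (λ y e → f≢g x y (sym e)) gy∈

∈-take⁺ : ∀ (xs : List A) (p : Fin (length xs)) {i} → toℕ p < i → lookup xs p ∈ take i xs
∈-take⁺ (x ∷ xs) zero    {suc i} _         = here refl
∈-take⁺ (x ∷ xs) (suc p) {suc i} (s≤s p<i) = there (∈-take⁺ xs p p<i)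

∈-drop⁺ : ∀ (xs : List A) (p : Fin (length xs)) {i} → i ≤ toℕ p → lookup xs p ∈ drop i xs
∈-drop⁺ xs       p       {zero}  _         = ∈-lookup p
∈-drop⁺ (x ∷ xs) (suc p) {suc i} (s≤s i≤p) = ∈-drop⁺ xs p i≤p

∈-take⁻ : ∀ (xs : List A) i {x} → x ∈ take i xs → ∃ λ p → toℕ p < i × lookup xs p ≡ x
∈-take⁻ (y ∷ xs) (suc i) (here refl) = zero , s≤s z≤n , refl
∈-take⁻ (y ∷ xs) (suc i) (there x∈) with p , p<i , e ← ∈-take⁻ xs i x∈ = suc p , s≤s p<i , e

∈-drop⁻ : ∀ (xs : List A) i {x} → x ∈ drop i xs → ∃ λ p → i ≤ toℕ p × lookup xs p ≡ x
∈-drop⁻ xs       zero    x∈ = index x∈ , z≤n , sym (lookup-index x∈)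
∈-drop⁻ (y ∷ xs) (suc i) x∈ with p , i≤p , e ← ∈-drop⁻ xs i x∈ = suc p , s≤s i≤p , e

take-length-++ : ∀ (P Q : List A) → take (length P) (P ++ Q) ≡ P
take-length-++ []      Q = refl
take-length-++ (x ∷ P) Q = cong (x ∷_) (take-length-++ P Q)

drop-length-++ : ∀ (P Q : List A) → drop (length P) (P ++ Q) ≡ Q
drop-length-++ []      Q = refl
drop-length-++ (x ∷ P) Q = drop-length-++ P Q

lookup-head : ∀ {ys : List A} {x xs} → ys ≡ x ∷ xs → ∀ q → toℕ q ≡ 0 → lookup ys q ≡ x
lookup-head refl zero _ = refl

lookup-last : ∀ {ys : List A} {x} xs → ys ≡ xs ++ [ x ] → ∀ q → toℕ q ≡ length xs → lookup ys q ≡ x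
lookup-last []       refl zero    _ = refl
lookup-last (y ∷ xs) refl (suc q) e = lookup-last xs refl q (suc-injective e)

length-last : ∀ {ys : List A} {x} xs → ys ≡ xs ++ [ x ] → length ys ≡ suc (length xs)
length-last xs refl = trans (length-++ xs) (+-comm (length xs) 1)

-- Cut-rank certificates

module _ {V : Set} (adj : V → V → Bool) where

  record CutRank≤ (P Q : List V) (r : ℕ) : Set where
    field
      coeff      : V → Fin r → Bool
      basis      : Fin r → V → Bool
      factorises : ∀ x y → x ∈ P → y ∈ Q → adj x y ≡ xorSum (λ i → coeff x i ∧ basis i y)

  record TriangularCut (P Q : List V) (r : ℕ) : Set where
    field
      row col        : Fin r → V
      row∈           : ∀ i → row i ∈ P
      col∈           : ∀ i → col i ∈ Q
      diagonal       : ∀ i → adj (row i) (col i) ≡ true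
      below-diagonal : ∀ i j → toℕ j < toℕ i → adj (row i) (col j) ≡ false

  Width≤ : List V → ℕ → Set
  Width≤ ℓ r = ∀ P Q → P ++ Q ≡ ℓ → CutRank≤ P Q r

  -- The columns avoid v: when the layout is reversed inside a delta composition glued
  -- at v they become rows, which then see nothing outside this part.
  record Width≥ (ℓ : List V) (r : ℕ) (v : V) : Set where
    field
      front back : List V
      split      : front ++ back ≡ ℓ
      cut        : TriangularCut front back r
      col≢v      : ∀ i → TriangularCut.col cut i ≢ v

module _ {V : Set} {adj : V → V → Bool} where

  cutRank≤-[]ˡ : ∀ Q r → CutRank≤ adj [] Q r
  cutRank≤-[]ˡ Q r = record { coeff = λ _ _ → false ; basis = λ _ _ → false ; factorises = λ _ _ () }

  cutRank≤-[]ʳ : ∀ P r → CutRank≤ adj P [] r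
  cutRank≤-[]ʳ P r = record { coeff = λ _ _ → false ; basis = λ _ _ → false ; factorises = λ _ _ _ () }

  cutRank≤-[x]ˡ : ∀ x Q → CutRank≤ adj [ x ] Q 1
  cutRank≤-[x]ˡ x Q = record
    { coeff = λ _ _ → true ; basis = λ _ → adj x ; factorises = λ { _ y (here refl) _ → sym (xor-identityʳ _) } }

  cutRank≤-[y]ʳ : ∀ P y → CutRank≤ adj P [ y ] 1
  cutRank≤-[y]ʳ P y = record
    { coeff = λ x _ → adj x y ; basis = λ _ _ → true
    ; factorises = λ { x _ _ (here refl) → sym (trans (xor-identityʳ _) (∧-identityʳ _)) } }

  cutRank≤-transpose : (∀ x y → adj x y ≡ adj y x) → ∀ {P Q r} → CutRank≤ adj Q P r → CutRank≤ adj P Q r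
  cutRank≤-transpose adj-sym c = record
    { coeff      = λ x i → basis i x
    ; basis      = λ i y → coeff y i
    ; factorises = λ x y x∈ y∈ →
        trans (adj-sym x y) (trans (factorises y x y∈ x∈) (xorSum-cong (λ i → ∧-comm (coeff y i) (basis i x))))
    }
    where open CutRank≤ c

opposite-reverses-< : ∀ {r} (i j : Fin r) → toℕ j < toℕ i → toℕ (opposite i) < toℕ (opposite j)
opposite-reverses-< i j j<i rewrite opposite-prop i | opposite-prop j = ∸-monoʳ-< (s≤s j<i) (toℕ<n i)

-- nothing is a new twin of v, and ε decides whether it is adjacent to v.
addTwin : {V : Set} → (V → V → Bool) → DecidableEquality V → Bool → V → Maybe V → Maybe V → Bool
addTwin adj _≟_ ε v (just x) (just y) = adj x y
addTwin adj _≟_ ε v (just x) nothing  = if ⌊ x ≟ v ⌋ then ε else adj x v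
addTwin adj _≟_ ε v nothing  (just y) = if ⌊ y ≟ v ⌋ then ε else adj y v
addTwin adj _≟_ ε v nothing  nothing  = false

width≤-removeTwin : ∀ {V} {adj : V → V → Bool} {_≟_ ε v} {ℓ : List V} {r} →
  Width≤ (addTwin adj _≟_ ε v) (map just ℓ ++ [ nothing ]) r → Width≤ adj ℓ r
width≤-removeTwin W P Q P++Q≡ℓ = record
  { coeff      = coeff ∘ just
  ; basis      = λ i → basis i ∘ just
  ; factorises = λ x y x∈ y∈ → factorises (just x) (just y) (∈-map⁺ just x∈) (∈-++⁺ˡ (∈-map⁺ just y∈))
  }
  where open CutRank≤ (W (map just P) (map just Q ++ [ nothing ]) (map-++-∷ʳ just {P} {Q} nothing P++Q≡ℓ))

width≥-addTwin : ∀ {V} {adj : V → V → Bool} {_≟_ ε v ℓ r} →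
  Width≥ adj ℓ r v → Width≥ (addTwin adj _≟_ ε v) (map just ℓ ++ [ nothing ]) r (just v)
width≥-addTwin w = record
  { front = map just front
  ; back  = map just back ++ [ nothing ]
  ; split = map-++-∷ʳ just {front} {back} nothing split
  ; cut   = record
    { row = just ∘ row ; col = just ∘ col
    ; row∈ = ∈-map⁺ just ∘ row∈ ; col∈ = ∈-++⁺ˡ ∘ ∈-map⁺ just ∘ col∈
    ; diagonal = diagonal ; below-diagonal = below-diagonal }
  ; col≢v = λ i e → col≢v i (just-injective e)
  }
  where
  open Width≥ w
  open TriangularCut cut

module Transport {V W : Set} {adj : V → V → Bool} {adj′ : W → W → Bool}
  (f : V → W) (g : W → V) (g∘f≡id : ∀ x → g (f x) ≡ x) (preserves : ∀ x y → adj′ (f x) (f y) ≡ adj x y) where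

  f-injective : ∀ {x y} → f x ≡ f y → x ≡ y
  f-injective {x} {y} e = trans (sym (g∘f≡id x)) (trans (cong g e) (g∘f≡id y))

  cutRank≤ : ∀ {P Q r} → CutRank≤ adj P Q r → CutRank≤ adj′ (map f P) (map f Q) r
  cutRank≤ c = record
    { coeff      = coeff ∘ g
    ; basis      = λ i → basis i ∘ g
    ; factorises = λ x′ y′ x′∈ y′∈ → factorise (∈-map⁻ f x′∈) (∈-map⁻ f y′∈)
    }
    where
    open CutRank≤ c
    factorise : ∀ {x′ y′} → (∃ λ x → x ∈ _ × x′ ≡ f x) → (∃ λ y → y ∈ _ × y′ ≡ f y) →
      adj′ x′ y′ ≡ xorSum (λ i → coeff (g x′) i ∧ basis i (g y′))
    factorise (x , x∈ , refl) (y , y∈ , refl) = begin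
      adj′ (f x) (f y)                                     ≡⟨ preserves x y ⟩
      adj x y                                              ≡⟨ factorises x y x∈ y∈ ⟩
      xorSum (λ i → coeff x i ∧ basis i y)                 ≡⟨ cong₂ (λ a b → xorSum (λ i → coeff a i ∧ basis i b))
                                                               (sym (g∘f≡id x)) (sym (g∘f≡id y)) ⟩
      xorSum (λ i → coeff (g (f x)) i ∧ basis i (g (f y))) ∎
      where open ≡-Reasoning

  width≤ : ∀ {ℓ r} → Width≤ adj ℓ r → Width≤ adj′ (map f ℓ) r
  width≤ {ℓ} W P Q P++Q≡ with ℓ₁ , ℓ₂ , ℓ₁++ℓ₂≡ℓ , refl , refl ← ++≡map⁻ f P ℓ P++Q≡ =
    cutRank≤ (W ℓ₁ ℓ₂ ℓ₁++ℓ₂≡ℓ)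

  triangularCut : ∀ {P Q r} → TriangularCut adj P Q r → TriangularCut adj′ (map f P) (map f Q) r
  triangularCut t = record
    { row            = f ∘ row
    ; col            = f ∘ col
    ; row∈           = ∈-map⁺ f ∘ row∈
    ; col∈           = ∈-map⁺ f ∘ col∈
    ; diagonal       = λ i → trans (preserves _ _) (diagonal i)
    ; below-diagonal = λ i j j<i → trans (preserves _ _) (below-diagonal i j j<i)
    }
    where open TriangularCut t

  width≥ : ∀ {ℓ r v} → Width≥ adj ℓ r v → Width≥ adj′ (map f ℓ) r (f v)
  width≥ w = record
    { front = map f front
    ; back  = map f back
    ; split = trans (sym (map-++ f front back)) (cong (map f) split)
    ; cut   = triangularCut cut
    ; col≢v = λ i e → col≢v i (f-injective e)
    }
    where open Width≥ w

-- Graphs on an arbitrary vertex type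

record AbstractGraph : Set₁ where
  field
    Vertex     : Set
    adj        : Vertex → Vertex → Bool
    adj-sym    : ∀ x y → adj x y ≡ adj y x
    adj-irrefl : ∀ x → adj x x ≡ false
    _≟_        : DecidableEquality Vertex

record _≅_ (H H′ : AbstractGraph) : Set where
  open AbstractGraph
  field
    to        : Vertex H → Vertex H′
    from      : Vertex H′ → Vertex H
    from∘to   : ∀ x → from (to x) ≡ x
    to∘from   : ∀ y → to (from y) ≡ y
    preserves : ∀ x y → adj H′ (to x) (to y) ≡ adj H x y

-- The invariant of the induction over Δ_k. The neighbour of v provides the new diagonal
-- entry when a delta composition raises the width.
record TwinLayout (k : ℕ) (H : AbstractGraph) (v : AbstractGraph.Vertex H) : Set where
  open AbstractGraph H
  field
    rest      : List Vertex
    unique    : Unique (v ∷ rest)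
    complete  : ∀ x → x ∈ v ∷ rest
    width≤    : ∀ ε → Width≤ (addTwin adj _≟_ ε v) (map just (v ∷ rest) ++ [ nothing ]) (suc k)
    width≥    : Width≥ adj (v ∷ rest) (suc k) v
    neighbour : Vertex
    adjacent  : adj v neighbour ≡ true

twinLayout-≅ : ∀ {k H H′} (φ : H ≅ H′) {v} → TwinLayout k H v → TwinLayout k H′ (_≅_.to φ v)
twinLayout-≅ {k} {H} {H′} φ {v} L = record
  { rest      = map to rest
  ; unique    = map⁺ T.f-injective unique
  ; complete  = λ y → subst (_∈ map to (v ∷ rest)) (to∘from y) (∈-map⁺ to (complete (from y)))
  ; width≤    = λ ε → subst (λ ℓ → Width≤ (addTwin adj′ _≟′_ ε (to v)) ℓ (suc k)) layout-image (TwinT.width≤ ε (width≤ ε))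
  ; width≥    = T.width≥ width≥
  ; neighbour = to neighbour
  ; adjacent  = trans (preserves v neighbour) adjacent
  }
  where
  open _≅_ φ
  open AbstractGraph H
  open AbstractGraph H′ using () renaming (adj to adj′; _≟_ to _≟′_)
  open TwinLayout L
  module T = Transport {adj′ = adj′} to from from∘to preserves

  ≟-to : ∀ x → ⌊ to x ≟′ to v ⌋ ≡ ⌊ x ≟ v ⌋
  ≟-to x with to x ≟′ to v | x ≟ v
  ... | yes _  | yes _  = refl
  ... | no _   | no _   = refl
  ... | yes e  | no x≢v = contradiction (T.f-injective e) x≢v
  ... | no ne  | yes refl = contradiction refl ne

  from∘to-maybe : ∀ a → Maybe.map from (Maybe.map to a) ≡ a
  from∘to-maybe (just x) = cong just (from∘to x)
  from∘to-maybe nothing  = refl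

  preserves-twin : ∀ ε a b → addTwin adj′ _≟′_ ε (to v) (Maybe.map to a) (Maybe.map to b) ≡ addTwin adj _≟_ ε v a b
  preserves-twin ε (just x) (just y) = preserves x y
  preserves-twin ε (just x) nothing  rewrite ≟-to x = cong (if ⌊ x ≟ v ⌋ then ε else_) (preserves x v)
  preserves-twin ε nothing  (just y) rewrite ≟-to y = cong (if ⌊ y ≟ v ⌋ then ε else_) (preserves y v)
  preserves-twin ε nothing  nothing  = refl

  module TwinT (ε : Bool) = Transport {adj′ = addTwin adj′ _≟′_ ε (to v)} (Maybe.map to) (Maybe.map from) from∘to-maybe (preserves-twin ε)

  layout-image : map (Maybe.map to) (map just (v ∷ rest) ++ [ nothing ]) ≡ map just (to v ∷ map to rest) ++ [ nothing ]
  layout-image = trans (map-++ (Maybe.map to) (map just (v ∷ rest)) [ nothing ])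
    (cong (_++ [ nothing ]) (trans (sym (map-∘ (v ∷ rest))) (map-∘ (v ∷ rest))))

⌊≟⌋-refl : (_≟_ : DecidableEquality A) → ∀ x → ⌊ x ≟ x ⌋ ≡ true
⌊≟⌋-refl _≟_ x = trans (isYes≗does (x ≟ x)) (dec-true (x ≟ x) refl)

⌊≟⌋-≢ : (_≟_ : DecidableEquality A) → ∀ {x y} → x ≢ y → ⌊ x ≟ y ⌋ ≡ false
⌊≟⌋-≢ _≟_ {x} {y} x≢y = trans (isYes≗does (x ≟ y)) (dec-false (x ≟ y) x≢y)

⌊≟⌋-distinct : (_≟_ : DecidableEquality A) → ∀ {x y} t → x ≢ y → ⌊ x ≟ t ⌋ ∧ ⌊ y ≟ t ⌋ ≡ false
⌊≟⌋-distinct _≟_ {x} {y} t x≢y with x ≟ t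
... | no  _    = refl
... | yes refl = ⌊≟⌋-≢ _≟_ (x≢y ∘ sym)

module DeltaComposition (H₁ H₂ H₃ : AbstractGraph)
  (t₁ : AbstractGraph.Vertex H₁) (t₂ : AbstractGraph.Vertex H₂) (t₃ : AbstractGraph.Vertex H₃) where
  open AbstractGraph H₁ renaming (Vertex to V₁; adj to adj₁; adj-sym to adj-sym₁; adj-irrefl to adj-irrefl₁; _≟_ to _≟₁_)
  open AbstractGraph H₂ renaming (Vertex to V₂; adj to adj₂; adj-sym to adj-sym₂; adj-irrefl to adj-irrefl₂; _≟_ to _≟₂_)
  open AbstractGraph H₃ renaming (Vertex to V₃; adj to adj₃; adj-sym to adj-sym₃; adj-irrefl to adj-irrefl₃; _≟_ to _≟₃_)

  data VertexΔ : Set where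
    ι₁ : V₁ → VertexΔ
    ι₂ : V₂ → VertexΔ
    ι₃ : V₃ → VertexΔ

  ι₁-injective : ∀ {x y} → ι₁ x ≡ ι₁ y → x ≡ y
  ι₁-injective refl = refl
  ι₂-injective : ∀ {x y} → ι₂ x ≡ ι₂ y → x ≡ y
  ι₂-injective refl = refl
  ι₃-injective : ∀ {x y} → ι₃ x ≡ ι₃ y → x ≡ y
  ι₃-injective refl = refl

  _≟Δ_ : DecidableEquality VertexΔ
  ι₁ x ≟Δ ι₁ y = map′ (cong ι₁) ι₁-injective (x ≟₁ y)
  ι₂ x ≟Δ ι₂ y = map′ (cong ι₂) ι₂-injective (x ≟₂ y)
  ι₃ x ≟Δ ι₃ y = map′ (cong ι₃) ι₃-injective (x ≟₃ y)
  ι₁ _ ≟Δ ι₂ _ = no λ ()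
  ι₁ _ ≟Δ ι₃ _ = no λ ()
  ι₂ _ ≟Δ ι₁ _ = no λ ()
  ι₂ _ ≟Δ ι₃ _ = no λ ()
  ι₃ _ ≟Δ ι₁ _ = no λ ()
  ι₃ _ ≟Δ ι₂ _ = no λ ()

  chosen : VertexΔ → Bool
  chosen (ι₁ x) = ⌊ x ≟₁ t₁ ⌋
  chosen (ι₂ x) = ⌊ x ≟₂ t₂ ⌋
  chosen (ι₃ x) = ⌊ x ≟₃ t₃ ⌋

  adjΔ : VertexΔ → VertexΔ → Bool
  adjΔ (ι₁ x) (ι₁ y) = adj₁ x y
  adjΔ (ι₂ x) (ι₂ y) = adj₂ x y
  adjΔ (ι₃ x) (ι₃ y) = adj₃ x y
  adjΔ x      y      = chosen x ∧ chosen y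

  adjΔ-sym : ∀ x y → adjΔ x y ≡ adjΔ y x
  adjΔ-sym (ι₁ x) (ι₁ y) = adj-sym₁ x y
  adjΔ-sym (ι₁ x) (ι₂ y) = ∧-comm (chosen (ι₁ x)) (chosen (ι₂ y))
  adjΔ-sym (ι₁ x) (ι₃ y) = ∧-comm (chosen (ι₁ x)) (chosen (ι₃ y))
  adjΔ-sym (ι₂ x) (ι₁ y) = ∧-comm (chosen (ι₂ x)) (chosen (ι₁ y))
  adjΔ-sym (ι₂ x) (ι₂ y) = adj-sym₂ x y
  adjΔ-sym (ι₂ x) (ι₃ y) = ∧-comm (chosen (ι₂ x)) (chosen (ι₃ y))
  adjΔ-sym (ι₃ x) (ι₁ y) = ∧-comm (chosen (ι₃ x)) (chosen (ι₁ y))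
  adjΔ-sym (ι₃ x) (ι₂ y) = ∧-comm (chosen (ι₃ x)) (chosen (ι₂ y))
  adjΔ-sym (ι₃ x) (ι₃ y) = adj-sym₃ x y

  adjΔ-irrefl : ∀ x → adjΔ x x ≡ false
  adjΔ-irrefl (ι₁ x) = adj-irrefl₁ x
  adjΔ-irrefl (ι₂ x) = adj-irrefl₂ x
  adjΔ-irrefl (ι₃ x) = adj-irrefl₃ x

  graph : AbstractGraph
  graph = record { Vertex = VertexΔ ; adj = adjΔ ; adj-sym = adjΔ-sym ; adj-irrefl = adjΔ-irrefl ; _≟_ = _≟Δ_ }

rotate : ∀ H₁ H₂ H₃ t₁ t₂ t₃ → DeltaComposition.graph H₂ H₃ H₁ t₂ t₃ t₁ ≅ DeltaComposition.graph H₁ H₂ H₃ t₁ t₂ t₃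
rotate H₁ H₂ H₃ t₁ t₂ t₃ = record
  { to = to ; from = from ; from∘to = from∘to ; to∘from = to∘from ; preserves = preserves }
  where
  open DeltaComposition using (VertexΔ; ι₁; ι₂; ι₃; adjΔ)
  to : VertexΔ H₂ H₃ H₁ t₂ t₃ t₁ → VertexΔ H₁ H₂ H₃ t₁ t₂ t₃
  to (ι₁ x) = ι₂ x
  to (ι₂ x) = ι₃ x
  to (ι₃ x) = ι₁ x
  from : VertexΔ H₁ H₂ H₃ t₁ t₂ t₃ → VertexΔ H₂ H₃ H₁ t₂ t₃ t₁
  from (ι₁ x) = ι₃ x
  from (ι₂ x) = ι₁ x
  from (ι₃ x) = ι₂ x
  from∘to : ∀ x → from (to x) ≡ x
  from∘to (ι₁ x) = refl
  from∘to (ι₂ x) = refl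
  from∘to (ι₃ x) = refl
  to∘from : ∀ x → to (from x) ≡ x
  to∘from (ι₁ x) = refl
  to∘from (ι₂ x) = refl
  to∘from (ι₃ x) = refl
  preserves : ∀ x y → adjΔ H₁ H₂ H₃ t₁ t₂ t₃ (to x) (to y) ≡ adjΔ H₂ H₃ H₁ t₂ t₃ t₁ x y
  preserves (ι₁ x) (ι₁ y) = refl
  preserves (ι₁ x) (ι₂ y) = refl
  preserves (ι₁ x) (ι₃ y) = refl
  preserves (ι₂ x) (ι₁ y) = refl
  preserves (ι₂ x) (ι₂ y) = refl
  preserves (ι₂ x) (ι₃ y) = refl
  preserves (ι₃ x) (ι₁ y) = refl
  preserves (ι₃ x) (ι₂ y) = refl
  preserves (ι₃ x) (ι₃ y) = refl

-- Layouts of delta compositions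

module DeltaLayout (H₁ H₂ H₃ : AbstractGraph)
  (t₁ : AbstractGraph.Vertex H₁) (t₂ : AbstractGraph.Vertex H₂) (t₃ : AbstractGraph.Vertex H₃)
  {k : ℕ} {a : AbstractGraph.Vertex H₁}
  (L₁ : TwinLayout k H₁ a) (L₂ : TwinLayout k H₂ t₂) (L₃ : TwinLayout k H₃ t₃) where
  open DeltaComposition H₁ H₂ H₃ t₁ t₂ t₃
  open AbstractGraph H₁ using () renaming (adj to adj₁; adj-irrefl to adj-irrefl₁; _≟_ to _≟₁_)
  open AbstractGraph H₂ using () renaming (Vertex to V₂; _≟_ to _≟₂_)
  open AbstractGraph H₃ using () renaming (adj-sym to adj-sym₃; _≟_ to _≟₃_)
  open TwinLayout L₁ using () renaming (rest to rest₁; unique to unique₁; complete to complete₁; width≤ to width≤₁;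
                                        neighbour to y₀; adjacent to a~y₀)
  open TwinLayout L₂ using () renaming (rest to rest₂; unique to unique₂; complete to complete₂; width≤ to width≤₂)
  open TwinLayout L₃ using () renaming (rest to rest₃; unique to unique₃; complete to complete₃; width≤ to width≤₃;
                                        width≥ to width≥₃)

  ℓ₂ : List V₂
  ℓ₂ = t₂ ∷ rest₂
  H₃-part : List VertexΔ
  H₃-part = map ι₃ (reverse rest₃)
  H₁H₂-part : List VertexΔ
  H₁H₂-part = map ι₁ rest₁ ++ map ι₂ ℓ₂
  after-H₃ : List VertexΔ
  after-H₃ = ι₃ t₃ ∷ H₁H₂-part
  order : List VertexΔ
  order = ι₁ a ∷ H₃-part ++ after-H₃

  ι₃∉H₁H₂-part : ∀ {x} → ι₃ x ∉ H₁H₂-part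
  ι₃∉H₁H₂-part x∈ with ∈-++⁻ (map ι₁ rest₁) x∈
  ... | inj₁ x∈₁ = ∉-map ι₁ (λ _ ()) x∈₁
  ... | inj₂ x∈₂ = ∉-map ι₂ (λ _ ()) x∈₂

  ι₁a∉ : ι₁ a ∉ H₃-part ++ after-H₃
  ι₁a∉ a∈ with ∈-++⁻ H₃-part a∈
  ... | inj₁ a∈₃ = ∉-map ι₃ (λ _ ()) a∈₃
  ... | inj₂ (there a∈′) with ∈-++⁻ (map ι₁ rest₁) a∈′
  ...   | inj₁ a∈₁ = Unique[x∷xs]⇒x∉xs unique₁ (∈-map⁻-injective ι₁ ι₁-injective a∈₁)
  ...   | inj₂ a∈₂ = ∉-map ι₂ (λ _ ()) a∈₂

  unique-order : Unique order
  unique-order = unique-∷ ι₁a∉ (++⁺ unique-H₃-part unique-after-H₃ H₃-part-disjoint)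
    where
    unique-H₃-part : Unique H₃-part
    unique-H₃-part = map⁺ ι₃-injective (unique-reverse (unique-tail unique₃))
    unique-after-H₃ : Unique after-H₃
    unique-after-H₃ = unique-∷ ι₃∉H₁H₂-part
      (++⁺ (map⁺ ι₁-injective (unique-tail unique₁)) (map⁺ ι₂-injective unique₂) (disjoint-map ι₁ ι₂ (λ _ _ ())))
    H₃-part-disjoint : Disjoint H₃-part after-H₃
    H₃-part-disjoint (x∈ , x∈′) with x , x∈₃ , refl ← ∈-map⁻ ι₃ x∈ with x∈′
    ... | here e    = Unique[x∷xs]⇒x∉xs unique₃ (subst (_∈ rest₃) (ι₃-injective e) (∈-reverse⁻ x∈₃))
    ... | there x∈″ = ι₃∉H₁H₂-part x∈″

  complete-order : ∀ x → x ∈ order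
  complete-order (ι₁ x) with complete₁ x
  ... | here refl = here refl
  ... | there x∈  = there (∈-++⁺ʳ H₃-part (there (∈-++⁺ˡ (∈-map⁺ ι₁ x∈))))
  complete-order (ι₂ x) = there (∈-++⁺ʳ H₃-part (there (∈-++⁺ʳ (map ι₁ rest₁) (∈-map⁺ ι₂ (complete₂ x)))))
  complete-order (ι₃ x) with complete₃ x
  ... | here refl = there (∈-++⁺ʳ H₃-part (here refl))
  ... | there x∈  = there (∈-++⁺ˡ (∈-map⁺ ι₃ (∈-reverse⁺ x∈)))

  y₀≢a : y₀ ≢ a
  y₀≢a refl with () ← trans (sym a~y₀) (adj-irrefl₁ a)

  y₀∈rest₁ : y₀ ∈ rest₁
  y₀∈rest₁ with complete₁ y₀
  ... | here y₀≡a = contradiction y₀≡a y₀≢a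
  ... | there y∈  = y∈

  open Width≥ width≥₃ using () renaming (front to front₃; back to back₃; split to split₃; cut to cut₃; col≢v to col≢t₃)
  open TriangularCut cut₃

  reversed-split : ∀ {P Q} → P ++ Q ≡ rest₃ → map ι₃ (reverse Q) ++ map ι₃ (reverse P) ++ after-H₃ ≡ H₃-part ++ after-H₃
  reversed-split {P} {Q} P++Q≡ = begin
    map ι₃ (reverse Q) ++ map ι₃ (reverse P) ++ after-H₃   ≡⟨ sym (++-assoc (map ι₃ (reverse Q)) _ after-H₃) ⟩
    (map ι₃ (reverse Q) ++ map ι₃ (reverse P)) ++ after-H₃ ≡⟨ cong (_++ after-H₃) (sym (map-++ ι₃ (reverse Q) _)) ⟩
    map ι₃ (reverse Q ++ reverse P) ++ after-H₃            ≡⟨ cong (λ l → map ι₃ l ++ after-H₃) (sym (reverse-++ P Q)) ⟩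
    map ι₃ (reverse (P ++ Q)) ++ after-H₃                  ≡⟨ cong (λ l → map ι₃ (reverse l) ++ after-H₃) P++Q≡ ⟩
    H₃-part ++ after-H₃                                    ∎
    where open ≡-Reasoning

  -- The triangular cut of H₃, read backwards, extended by the entry a y₀.
  width≥-order : Width≥ adjΔ order (suc (suc k)) (ι₁ a)
  width≥-order with ++≡∷⁻ front₃ split₃
  ... | inj₁ (refl , _) with () ← row∈ zero
  ... | inj₂ (front′ , refl , front′++back≡rest₃) = record
    { front = ι₁ a ∷ map ι₃ (reverse back₃)
    ; back  = map ι₃ (reverse front′) ++ after-H₃
    ; split = cong (ι₁ a ∷_) (reversed-split {front′} {back₃} front′++back≡rest₃)
    ; cut = record
      { row = row′ ; col = col′ ; row∈ = row′∈ ; col∈ = col′∈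
      ; diagonal = diagonal′ ; below-diagonal = below-diagonal′ }
    ; col≢v = col′≢a
    }
    where
    row′ : Fin (suc (suc k)) → VertexΔ
    row′ zero    = ι₁ a
    row′ (suc i) = ι₃ (col (opposite i))
    col′ : Fin (suc (suc k)) → VertexΔ
    col′ zero    = ι₁ y₀
    col′ (suc i) = ι₃ (row (opposite i))
    row′∈ : ∀ i → row′ i ∈ ι₁ a ∷ map ι₃ (reverse back₃)
    row′∈ zero    = here refl
    row′∈ (suc i) = there (∈-map⁺ ι₃ (∈-reverse⁺ (col∈ (opposite i))))
    col′∈ : ∀ i → col′ i ∈ map ι₃ (reverse front′) ++ after-H₃
    col′∈ zero = ∈-++⁺ʳ (map ι₃ (reverse front′)) (there (∈-++⁺ˡ (∈-map⁺ ι₁ y₀∈rest₁)))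
    col′∈ (suc i) with row∈ (opposite i)
    ... | here e  = ∈-++⁺ʳ (map ι₃ (reverse front′)) (here (cong ι₃ e))
    ... | there r∈ = ∈-++⁺ˡ (∈-map⁺ ι₃ (∈-reverse⁺ r∈))
    diagonal′ : ∀ i → adjΔ (row′ i) (col′ i) ≡ true
    diagonal′ zero    = a~y₀
    diagonal′ (suc i) = trans (adj-sym₃ _ _) (diagonal (opposite i))
    below-diagonal′ : ∀ i j → toℕ j < toℕ i → adjΔ (row′ i) (col′ j) ≡ false
    below-diagonal′ (suc i) zero    _         = cong (_∧ chosen (ι₁ y₀)) (⌊≟⌋-≢ _≟₃_ (col≢t₃ (opposite i)))
    below-diagonal′ (suc i) (suc j) (s≤s j<i) =
      trans (adj-sym₃ _ _) (below-diagonal (opposite j) (opposite i) (opposite-reverses-< i j j<i))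
    col′≢a : ∀ i → col′ i ≢ ι₁ a
    col′≢a zero    e = y₀≢a (ι₁-injective e)
    col′≢a (suc i) ()

  twin : Bool → Maybe VertexΔ → Maybe VertexΔ → Bool
  twin ε = addTwin adjΔ _≟Δ_ ε (ι₁ a)

  xorSum-∧-false : (f : Fin r → Bool) → xorSum (λ i → f i ∧ false) ≡ false
  xorSum-∧-false f = xorSum-false (λ i → ∧-zeroʳ (f i))

  -- The row of a is the only one outside H₃; the rows of H₃ see only H₃, as t₃ is behind the cut.
  module CutInH₃ (ε : Bool) {A B} (A++B≡ : A ++ B ≡ reverse rest₃) where
    open CutRank≤ (cutRank≤-transpose adj-sym₃
      (width≤-removeTwin (width≤₃ false) (t₃ ∷ reverse B) (reverse A) (cong (t₃ ∷_) (++≡reverse⁻ A B rest₃ A++B≡))))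

    Suffix : List (Maybe VertexΔ)
    Suffix = map just (map ι₃ B ++ after-H₃) ++ [ nothing ]

    coeff′ : Maybe VertexΔ → Fin (suc (suc k)) → Bool
    coeff′ (just (ι₁ _)) zero    = true
    coeff′ (just (ι₃ x)) (suc i) = coeff x i
    coeff′ _             _       = false

    basis′ : Fin (suc (suc k)) → Maybe VertexΔ → Bool
    basis′ zero    y             = twin ε (just (ι₁ a)) y
    basis′ (suc i) (just (ι₃ y)) = basis i y
    basis′ (suc i) _             = false

    col∈H₃ : ∀ {y} → just (ι₃ y) ∈ Suffix → y ∈ t₃ ∷ reverse B
    col∈H₃ y∈ with ∈-++⁻ (map ι₃ B) (just∈⁻ (map ι₃ B ++ after-H₃) y∈)
    ... | inj₁ y∈B          = there (∈-reverse⁺ (∈-map⁻-injective ι₃ ι₃-injective y∈B))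
    ... | inj₂ (here e)     = here (ι₃-injective e)
    ... | inj₂ (there y∈′)  = contradiction y∈′ ι₃∉H₁H₂-part

    unchosen : ∀ {x} → x ∈ A → chosen (ι₃ x) ≡ false
    unchosen {x} x∈A = ⌊≟⌋-≢ _≟₃_ λ x≡t₃ →
      Unique[x∷xs]⇒x∉xs unique₃ (subst (_∈ rest₃) x≡t₃ (∈-reverse⁻ (subst (x ∈_) A++B≡ (∈-++⁺ˡ x∈A))))

    row-H₃ : ∀ x → x ∈ A → ∀ y → y ∈ Suffix → twin ε (just (ι₃ x)) y ≡ xorSum (λ i → coeff x i ∧ basis′ (suc i) y)
    row-H₃ x x∈A nothing       _  = trans (cong (_∧ _) (unchosen x∈A)) (sym (xorSum-∧-false (coeff x)))
    row-H₃ x x∈A (just (ι₁ y)) _  = trans (cong (_∧ _) (unchosen x∈A)) (sym (xorSum-∧-false (coeff x)))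
    row-H₃ x x∈A (just (ι₂ y)) _  = trans (cong (_∧ _) (unchosen x∈A)) (sym (xorSum-∧-false (coeff x)))
    row-H₃ x x∈A (just (ι₃ y)) y∈ = factorises x y (∈-reverse⁺ x∈A) (col∈H₃ y∈)

    factorises′ : ∀ x y → x ∈ map just (ι₁ a ∷ map ι₃ A) → y ∈ Suffix → twin ε x y ≡ xorSum (λ i → coeff′ x i ∧ basis′ i y)
    factorises′ _ y (here refl) _ =
      sym (trans (cong (twin ε (just (ι₁ a)) y xor_) (xorSum-false {suc k} (λ _ → refl))) (xor-identityʳ _))
    factorises′ x y (there x∈) y∈ with x′ , x′∈ , refl ← ∈-map⁻ just x∈ with x″ , x″∈ , refl ← ∈-map⁻ ι₃ x′∈ =
      row-H₃ x″ x″∈ y y∈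

    certificate : CutRank≤ (twin ε) (map just (ι₁ a ∷ map ι₃ A)) Suffix (suc (suc k))
    certificate = record { coeff = coeff′ ; basis = basis′ ; factorises = factorises′ }

  -- The twin entry of a row x of H₁ differs from the one in H₁ by chosen x ∧ chosen a, the twin
  -- entry of the row of t₃; flipping ε when a = t₁ makes this hold for x = a too.
  twin-in-H₁ : ∀ ε x → twin ε (just (ι₁ x)) nothing ≡
    (chosen (ι₁ x) ∧ chosen (ι₁ a)) xor addTwin adj₁ _≟₁_ (if chosen (ι₁ a) then not ε else ε) a (just x) nothing
  twin-in-H₁ ε x with x ≟₁ a
  ... | no x≢a  = sym (cong (_xor adj₁ x a) (⌊≟⌋-distinct _≟₁_ t₁ x≢a))
  ... | yes refl with x ≟₁ t₁
  ...   | yes _ = sym (not-involutive ε)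
  ...   | no  _ = refl

  via-t₃ : ∀ c d (f : Fin (suc k) → Bool) → (∀ i → f i ≡ false) → c ∧ d ≡ (c ∧ (chosen (ι₃ t₃) ∧ d)) xor xorSum f
  via-t₃ c d f f≡0 =
    sym (trans (cong₂ (λ u v → (c ∧ (u ∧ d)) xor v) (⌊≟⌋-refl _≟₃_ t₃) (xorSum-false f≡0)) (xor-identityʳ _))

  -- Every row of H₃ is a multiple of the row of t₃, and so is the difference between a row
  -- of H₁ and its restriction to H₁ (with the twin).
  module CutInH₁ (ε : Bool) {A B} (A++B≡ : A ++ B ≡ rest₁) where

    open CutRank≤ (width≤₁ (if chosen (ι₁ a) then not ε else ε) (map just (a ∷ A)) (map just B ++ [ nothing ])
                    (map-++-∷ʳ just {a ∷ A} {B} nothing (cong (a ∷_) A++B≡)))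

    coeff′ : Maybe VertexΔ → Fin (suc (suc k)) → Bool
    coeff′ (just (ι₁ x)) zero    = chosen (ι₁ x)
    coeff′ (just (ι₁ x)) (suc i) = coeff (just x) i
    coeff′ (just (ι₃ x)) zero    = chosen (ι₃ x)
    coeff′ _             _       = false

    basis′ : Fin (suc (suc k)) → Maybe VertexΔ → Bool
    basis′ zero    y             = twin ε (just (ι₃ t₃)) y
    basis′ (suc i) (just (ι₁ y)) = basis i (just y)
    basis′ (suc i) nothing       = basis i nothing
    basis′ (suc i) _             = false

    Prefix : List VertexΔ
    Prefix = ι₁ a ∷ H₃-part ++ ι₃ t₃ ∷ map ι₁ A

    Suffix : List (Maybe VertexΔ)
    Suffix = map just (map ι₁ B ++ map ι₂ ℓ₂) ++ [ nothing ]

    row∈H₁ : ∀ {x} → ι₁ x ∈ Prefix → x ∈ a ∷ A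
    row∈H₁ (here e) = here (ι₁-injective e)
    row∈H₁ (there x∈) with ∈-++⁻ H₃-part x∈
    ... | inj₁ x∈₃         = contradiction x∈₃ (∉-map ι₃ (λ _ ()))
    ... | inj₂ (there x∈₁) = there (∈-map⁻-injective ι₁ ι₁-injective x∈₁)

    row∉H₂ : ∀ {x} → ι₂ x ∉ Prefix
    row∉H₂ (there x∈) with ∈-++⁻ H₃-part x∈
    ... | inj₁ x∈₃         = ∉-map ι₃ (λ _ ()) x∈₃
    ... | inj₂ (there x∈₁) = ∉-map ι₁ (λ _ ()) x∈₁

    col-in-Suffix : ∀ {y} → just y ∈ Suffix → y ∈ map ι₁ B ++ map ι₂ ℓ₂
    col-in-Suffix = just∈⁻ (map ι₁ B ++ map ι₂ ℓ₂)

    col∈B : ∀ {y} → just (ι₁ y) ∈ Suffix → y ∈ B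
    col∈B y∈ with ∈-++⁻ (map ι₁ B) (col-in-Suffix y∈)
    ... | inj₁ y∈B = ∈-map⁻-injective ι₁ ι₁-injective y∈B
    ... | inj₂ y∈₂ = contradiction y∈₂ (∉-map ι₂ (λ _ ()))

    col∉H₃ : ∀ {y} → just (ι₃ y) ∉ Suffix
    col∉H₃ y∈ with ∈-++⁻ (map ι₁ B) (col-in-Suffix y∈)
    ... | inj₁ y∈₁ = ∉-map ι₁ (λ _ ()) y∈₁
    ... | inj₂ y∈₂ = ∉-map ι₂ (λ _ ()) y∈₂

    row-H₁ : ∀ x → x ∈ a ∷ A → ∀ y → y ∈ Suffix → twin ε (just (ι₁ x)) y ≡ xorSum (λ i → coeff′ (just (ι₁ x)) i ∧ basis′ i y)
    row-H₁ x x∈ nothing _ = begin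
      twin ε (just (ι₁ x)) nothing
        ≡⟨ twin-in-H₁ ε x ⟩
      (chosen (ι₁ x) ∧ chosen (ι₁ a)) xor _
        ≡⟨ cong₂ (λ u v → (chosen (ι₁ x) ∧ (u ∧ chosen (ι₁ a))) xor v) (sym (⌊≟⌋-refl _≟₃_ t₃))
             (factorises (just x) nothing (∈-map⁺ just x∈) (∈-++⁺ʳ (map just B) (here refl))) ⟩
      (chosen (ι₁ x) ∧ (chosen (ι₃ t₃) ∧ chosen (ι₁ a))) xor xorSum (λ i → coeff (just x) i ∧ basis i nothing) ∎
      where open ≡-Reasoning
    row-H₁ x x∈ (just (ι₁ y)) y∈ = begin
      adj₁ x y
        ≡⟨ factorises (just x) (just y) (∈-map⁺ just x∈) (∈-++⁺ˡ (∈-map⁺ just (col∈B y∈))) ⟩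
      xorSum (λ i → coeff (just x) i ∧ basis i (just y))
        ≡⟨ cong (_xor xorSum (λ i → coeff (just x) i ∧ basis i (just y))) (sym (⌊≟⌋-distinct _≟₁_ t₁ x≢y)) ⟩
      (chosen (ι₁ x) ∧ chosen (ι₁ y)) xor xorSum (λ i → coeff (just x) i ∧ basis i (just y))
        ≡⟨ cong (λ u → (chosen (ι₁ x) ∧ (u ∧ chosen (ι₁ y))) xor xorSum (λ i → coeff (just x) i ∧ basis i (just y)))
             (sym (⌊≟⌋-refl _≟₃_ t₃)) ⟩
      (chosen (ι₁ x) ∧ (chosen (ι₃ t₃) ∧ chosen (ι₁ y))) xor xorSum (λ i → coeff (just x) i ∧ basis i (just y)) ∎
      where
      open ≡-Reasoning
      x≢y : x ≢ y
      x≢y refl = unique-++⇒disjoint (a ∷ A) (subst Unique (cong (a ∷_) (sym A++B≡)) unique₁) (x∈ , col∈B y∈)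
    row-H₁ x x∈ (just (ι₂ y)) _  = via-t₃ (chosen (ι₁ x)) (chosen (ι₂ y)) _ (λ i → ∧-zeroʳ (coeff (just x) i))
    row-H₁ x x∈ (just (ι₃ y)) y∈ = contradiction y∈ col∉H₃

    row-H₃ : ∀ x y → y ∈ Suffix → twin ε (just (ι₃ x)) y ≡ xorSum (λ i → coeff′ (just (ι₃ x)) i ∧ basis′ i y)
    row-H₃ x nothing       _  = via-t₃ (chosen (ι₃ x)) (chosen (ι₁ a)) _ (λ _ → refl)
    row-H₃ x (just (ι₁ y)) _  = via-t₃ (chosen (ι₃ x)) (chosen (ι₁ y)) _ (λ _ → refl)
    row-H₃ x (just (ι₂ y)) _  = via-t₃ (chosen (ι₃ x)) (chosen (ι₂ y)) _ (λ _ → refl)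
    row-H₃ x (just (ι₃ y)) y∈ = contradiction y∈ col∉H₃

    factorises′ : ∀ x y → x ∈ map just Prefix → y ∈ Suffix → twin ε x y ≡ xorSum (λ i → coeff′ x i ∧ basis′ i y)
    factorises′ x y x∈ y∈ with ∈-map⁻ just x∈
    ... | ι₁ x′ , x′∈ , refl = row-H₁ x′ (row∈H₁ x′∈) y y∈
    ... | ι₂ x′ , x′∈ , refl = contradiction x′∈ row∉H₂
    ... | ι₃ x′ , x′∈ , refl = row-H₃ x′ y y∈

    certificate : CutRank≤ (twin ε) (map just Prefix) Suffix (suc (suc k))
    certificate = record { coeff = coeff′ ; basis = basis′ ; factorises = factorises′ }

  -- Behind the cut only the twin column leaves H₂: the remaining columns of H₂ avoid t₂.
  module CutInH₂ (ε : Bool) {A B} (A++B≡ : A ++ B ≡ rest₂) where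
    open CutRank≤ (width≤-removeTwin (width≤₂ false) (t₂ ∷ A) B (cong (t₂ ∷_) A++B≡))

    coeff′ : Maybe VertexΔ → Fin (suc (suc k)) → Bool
    coeff′ x             zero    = twin ε x nothing
    coeff′ (just (ι₂ x)) (suc i) = coeff x i
    coeff′ _             (suc i) = false

    basis′ : Fin (suc (suc k)) → Maybe VertexΔ → Bool
    basis′ zero    (just _)      = false
    basis′ zero    nothing       = true
    basis′ (suc i) (just (ι₂ y)) = basis i y
    basis′ (suc i) _             = false

    Prefix : List VertexΔ
    Prefix = ι₁ a ∷ H₃-part ++ ι₃ t₃ ∷ map ι₁ rest₁ ++ map ι₂ (t₂ ∷ A)

    Suffix : List (Maybe VertexΔ)
    Suffix = map just (map ι₂ B) ++ [ nothing ]

    row∈H₂ : ∀ {x} → ι₂ x ∈ Prefix → x ∈ t₂ ∷ A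
    row∈H₂ (there x∈) with ∈-++⁻ H₃-part x∈
    ... | inj₁ x∈₃ = contradiction x∈₃ (∉-map ι₃ (λ _ ()))
    ... | inj₂ (there x∈′) with ∈-++⁻ (map ι₁ rest₁) x∈′
    ...   | inj₁ x∈₁ = contradiction x∈₁ (∉-map ι₁ (λ _ ()))
    ...   | inj₂ x∈₂ = ∈-map⁻-injective ι₂ ι₂-injective x∈₂

    unchosen : ∀ {y} → y ∈ B → chosen (ι₂ y) ≡ false
    unchosen y∈B = ⌊≟⌋-≢ _≟₂_ λ { refl → Unique[x∷xs]⇒x∉xs unique₂ (subst (_ ∈_) A++B≡ (∈-++⁺ʳ A y∈B)) }

    vanishing : ∀ c → false ≡ (c ∧ false) xor xorSum {suc k} (λ _ → false)
    vanishing c = sym (trans (cong (_xor xorSum {suc k} (λ _ → false)) (∧-zeroʳ c)) (xorSum-false {suc k} (λ _ → refl)))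

    factorises′ : ∀ x y → x ∈ map just Prefix → y ∈ Suffix → twin ε x y ≡ xorSum (λ i → coeff′ x i ∧ basis′ i y)
    factorises′ x nothing _ _ =
      sym (trans (cong₂ _xor_ (∧-identityʳ (twin ε x nothing)) (xorSum-∧-false (λ i → coeff′ x (suc i))))
                 (xor-identityʳ (twin ε x nothing)))
    factorises′ x (just y) x∈ y∈ with y′ , y′∈ , refl ← ∈-map⁻ ι₂ (just∈⁻ (map ι₂ B) y∈) with ∈-map⁻ just x∈
    ... | ι₁ x′ , _ , refl = trans (cong (chosen (ι₁ x′) ∧_) (unchosen y′∈)) (trans (∧-zeroʳ _) (vanishing (twin ε (just (ι₁ x′)) nothing)))
    ... | ι₃ x′ , _ , refl = trans (cong (chosen (ι₃ x′) ∧_) (unchosen y′∈)) (trans (∧-zeroʳ _) (vanishing (twin ε (just (ι₃ x′)) nothing)))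
    ... | ι₂ x′ , x′∈ , refl = trans (factorises x′ y′ (row∈H₂ x′∈) y′∈)
                                 (sym (cong (_xor xorSum (λ i → coeff x′ i ∧ basis i y′)) (∧-zeroʳ (twin ε (just (ι₂ x′)) nothing))))

    certificate : CutRank≤ (twin ε) (map just Prefix) Suffix (suc (suc k))
    certificate = record { coeff = coeff′ ; basis = basis′ ; factorises = factorises′ }

  cut-order : ∀ ε P Q → P ++ Q ≡ order → CutRank≤ (twin ε) (map just P) (map just Q ++ [ nothing ]) (suc (suc k))
  cut-order ε P Q P++Q≡ with ++≡∷⁻ P P++Q≡
  ... | inj₁ (refl , _) = cutRank≤-[]ˡ _ _
  ... | inj₂ (P′ , refl , P′++Q≡) with ++≡++⁻ P′ H₃-part P′++Q≡
  ...   | inj₁ (Q′ , P′++Q′≡ , refl)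
          with A , B , A++B≡ , refl , refl ← ++≡map⁻ ι₃ P′ (reverse rest₃) P′++Q′≡ = CutInH₃.certificate ε A++B≡
  ...   | inj₂ (_ , P″ , refl , e) with refl , P″++Q≡ ← ∷-injective e with ++≡++⁻ P″ (map ι₁ rest₁) P″++Q≡
  ...     | inj₁ (Q′ , P″++Q′≡ , refl)
            with A , B , A++B≡ , refl , refl ← ++≡map⁻ ι₁ P″ rest₁ P″++Q′≡ = CutInH₁.certificate ε A++B≡
  ...     | inj₂ (z , zs , refl , e′) with ++≡map⁻ ι₂ (z ∷ zs) ℓ₂ e′
  ...       | _ ∷ A , B , e″ , refl , refl with refl , A++B≡ ← ∷-injective e″ = CutInH₂.certificate ε A++B≡

  width≤-order : ∀ ε → Width≤ (twin ε) (map just order ++ [ nothing ]) (suc (suc k))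
  width≤-order ε P Q P++Q≡ with ++≡++⁻ P (map just order) P++Q≡
  ... | inj₁ (Q′ , P++Q′≡ , refl) with P′ , Q″ , P′++Q″≡ , refl , refl ← ++≡map⁻ just P order P++Q′≡ =
    cut-order ε P′ Q″ P′++Q″≡
  ... | inj₂ (_ , zs , refl , e) with refl , zs++Q≡[] ← ∷-injective e rewrite ++-conicalʳ zs Q zs++Q≡[] =
    cutRank≤-[]ʳ _ _

  twinLayout : TwinLayout (suc k) graph (ι₁ a)
  twinLayout = record
    { rest      = H₃-part ++ after-H₃
    ; unique    = unique-order
    ; complete  = complete-order
    ; width≤    = width≤-order
    ; width≥    = width≥-order
    ; neighbour = ι₁ y₀
    ; adjacent  = a~y₀
    }

-- Induction over Δ_k

twinLayout-≅-all : ∀ {k H H′} → H ≅ H′ → (∀ v → TwinLayout k H v) → ∀ v → TwinLayout k H′ v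
twinLayout-≅-all {k} {H′ = H′} φ L v = subst (TwinLayout k H′) (to∘from v) (twinLayout-≅ φ (L (from v)))
  where open _≅_ φ

-- Vertices of H₂ and H₃ come first in a rotation of the composition.
twinLayout-Δ : ∀ {k} H₁ H₂ H₃ t₁ t₂ t₃ →
  (∀ x → TwinLayout k H₁ x) → (∀ x → TwinLayout k H₂ x) → (∀ x → TwinLayout k H₃ x) →
  ∀ x → TwinLayout (suc k) (DeltaComposition.graph H₁ H₂ H₃ t₁ t₂ t₃) x
twinLayout-Δ H₁ H₂ H₃ t₁ t₂ t₃ L₁ L₂ L₃ (DeltaComposition.ι₁ x) =
  DeltaLayout.twinLayout H₁ H₂ H₃ t₁ t₂ t₃ (L₁ x) (L₂ t₂) (L₃ t₃)
twinLayout-Δ H₁ H₂ H₃ t₁ t₂ t₃ L₁ L₂ L₃ (DeltaComposition.ι₂ x) =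
  twinLayout-≅ (rotate H₁ H₂ H₃ t₁ t₂ t₃) (DeltaLayout.twinLayout H₂ H₃ H₁ t₂ t₃ t₁ (L₂ x) (L₃ t₃) (L₁ t₁))
twinLayout-Δ H₁ H₂ H₃ t₁ t₂ t₃ L₁ L₂ L₃ (DeltaComposition.ι₃ x) =
  twinLayout-≅ (rotate H₁ H₂ H₃ t₁ t₂ t₃) (twinLayout-≅ (rotate H₂ H₃ H₁ t₂ t₃ t₁)
    (DeltaLayout.twinLayout H₃ H₁ H₂ t₃ t₁ t₂ (L₃ x) (L₁ t₁) (L₂ t₂)))

twinLayout-edge : ∀ H {v u} → let open AbstractGraph H in
  adj v u ≡ true → v ≢ u → (∀ x → x ≡ v ⊎ x ≡ u) → TwinLayout 0 H v
twinLayout-edge H {v} {u} v~u v≢u v-or-u = record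
  { rest      = [ u ]
  ; unique    = unique-∷ (λ { (here v≡u) → v≢u v≡u }) (unique-∷ (λ ()) [])
  ; complete  = λ x → [ (λ { refl → here refl }) , (λ { refl → there (here refl) }) ]′ (v-or-u x)
  ; width≤    = width≤
  ; width≥    = record
    { front = [ v ] ; back = [ u ] ; split = refl
    ; cut   = record
      { row = λ _ → v ; col = λ _ → u ; row∈ = λ _ → here refl ; col∈ = λ _ → here refl
      ; diagonal = λ _ → v~u ; below-diagonal = λ { zero zero () } }
    ; col≢v = λ _ u≡v → v≢u (sym u≡v)
    }
  ; neighbour = u
  ; adjacent  = v~u
  }
  where
  open AbstractGraph H
  width≤ : ∀ ε → Width≤ (addTwin adj _≟_ ε v) (just v ∷ just u ∷ nothing ∷ []) 1
  width≤ ε P Q P++Q≡ with ++≡∷⁻ P P++Q≡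
  ... | inj₁ (refl , _) = cutRank≤-[]ˡ _ _
  ... | inj₂ (P₁ , refl , e₁) with ++≡∷⁻ P₁ e₁
  ...   | inj₁ (refl , _) = cutRank≤-[x]ˡ _ _
  ...   | inj₂ (P₂ , refl , e₂) with ++≡∷⁻ P₂ e₂
  ...     | inj₁ (refl , refl) = cutRank≤-[y]ʳ _ _
  ...     | inj₂ (P₃ , refl , e₃) with P₃ | Q | e₃
  ...       | [] | [] | refl = cutRank≤-[]ʳ _ _

abstractGraph : ∀ {n} → Graph n → AbstractGraph
abstractGraph {n} G = record
  { Vertex = Fin n ; adj = Graph.adj G ; adj-sym = Graph.sym G ; adj-irrefl = Graph.irrefl G ; _≟_ = Fin._≟_ }

Iso⇒≅ : ∀ {n m} {G : Graph n} {H : Graph m} → Iso G H → abstractGraph G ≅ abstractGraph H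
Iso⇒≅ (π , preserves) = record
  { to = π ⟨$⟩ʳ_ ; from = π ⟨$⟩ˡ_ ; from∘to = λ _ → inverseˡ π ; to∘from = λ _ → inverseʳ π ; preserves = preserves }

twinLayout-K2 : ∀ v → TwinLayout 0 (abstractGraph K2) v
twinLayout-K2 zero       = twinLayout-edge (abstractGraph K2) refl (λ ()) λ { zero → inj₁ refl ; (suc zero) → inj₂ refl }
twinLayout-K2 (suc zero) = twinLayout-edge (abstractGraph K2) refl (λ ()) λ { zero → inj₂ refl ; (suc zero) → inj₁ refl }

module _ {n₁ n₂ n₃} (G₁ : Graph n₁) (G₂ : Graph n₂) (G₃ : Graph n₃) (v₁ : Fin n₁) (v₂ : Fin n₂) (v₃ : Fin n₃) where
  open DeltaComposition (abstractGraph G₁) (abstractGraph G₂) (abstractGraph G₃) v₁ v₂ v₃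
  open DeltaComp G₁ G₂ G₃ v₁ v₂ v₃ using (Part; loc; adjP)

  part : VertexΔ → Part
  part (ι₁ x) = inj₁ x
  part (ι₂ x) = inj₂ (inj₁ x)
  part (ι₃ x) = inj₂ (inj₂ x)

  unpart : Part → VertexΔ
  unpart = [ ι₁ , [ ι₂ , ι₃ ]′ ]′

  joinPart : Part → Fin (n₁ + (n₂ + n₃))
  joinPart p = join n₁ (n₂ + n₃) (Sum.map₂ (join n₂ n₃) p)

  loc∘joinPart : ∀ p → loc (joinPart p) ≡ p
  loc∘joinPart (inj₁ x)        rewrite splitAt-↑ˡ n₁ x (n₂ + n₃) = refl
  loc∘joinPart (inj₂ (inj₁ x)) rewrite splitAt-↑ʳ n₁ (n₂ + n₃) (x ↑ˡ n₃) | splitAt-↑ˡ n₂ x n₃ = refl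
  loc∘joinPart (inj₂ (inj₂ x)) rewrite splitAt-↑ʳ n₁ (n₂ + n₃) (n₂ ↑ʳ x) | splitAt-↑ʳ n₂ n₃ x = refl

  joinPart∘loc : ∀ x → joinPart (loc x) ≡ x
  joinPart∘loc x with splitAt n₁ {n₂ + n₃} x in e
  ... | inj₁ y = trans (cong (join n₁ _) (sym e)) (join-splitAt n₁ _ x)
  ... | inj₂ y = trans (cong (λ z → join n₁ (n₂ + n₃) (inj₂ z)) (join-splitAt n₂ n₃ y))
                       (trans (cong (join n₁ _) (sym e)) (join-splitAt n₁ _ x))

  adjP-part : ∀ x y → adjP (part x) (part y) ≡ adjΔ x y
  adjP-part (ι₁ x) (ι₁ y) = refl
  adjP-part (ι₁ x) (ι₂ y) = refl
  adjP-part (ι₁ x) (ι₃ y) = refl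
  adjP-part (ι₂ x) (ι₁ y) = refl
  adjP-part (ι₂ x) (ι₂ y) = refl
  adjP-part (ι₂ x) (ι₃ y) = refl
  adjP-part (ι₃ x) (ι₁ y) = refl
  adjP-part (ι₃ x) (ι₂ y) = refl
  adjP-part (ι₃ x) (ι₃ y) = refl

  deltaComp≅ : graph ≅ abstractGraph (deltaComp G₁ G₂ G₃ v₁ v₂ v₃)
  deltaComp≅ = record
    { to        = joinPart ∘ part
    ; from      = unpart ∘ loc
    ; from∘to   = λ x → trans (cong unpart (loc∘joinPart (part x))) (unpart∘part x)
    ; to∘from   = λ y → trans (joinPart∘part∘unpart (loc y)) (joinPart∘loc y)
    ; preserves = λ x y → trans (cong₂ adjP (loc∘joinPart (part x)) (loc∘joinPart (part y))) (adjP-part x y)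
    }
    where
    unpart∘part : ∀ x → unpart (part x) ≡ x
    unpart∘part (ι₁ x) = refl
    unpart∘part (ι₂ x) = refl
    unpart∘part (ι₃ x) = refl
    joinPart∘part∘unpart : ∀ p → joinPart (part (unpart p)) ≡ joinPart p
    joinPart∘part∘unpart (inj₁ x)        = refl
    joinPart∘part∘unpart (inj₂ (inj₁ x)) = refl
    joinPart∘part∘unpart (inj₂ (inj₂ x)) = refl

twinLayout-InΔ : ∀ {k n} {G : Graph n} → InΔ k G → ∀ v → TwinLayout k (abstractGraph G) v
twinLayout-InΔ (base iso) = twinLayout-≅-all (Iso⇒≅ iso) twinLayout-K2
twinLayout-InΔ (step {G₁ = G₁} {G₂} {G₃} d₁ d₂ d₃ v₁ v₂ v₃ iso) =
  twinLayout-≅-all (Iso⇒≅ iso) (twinLayout-≅-all (deltaComp≅ G₁ G₂ G₃ v₁ v₂ v₃)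
    (twinLayout-Δ _ _ _ v₁ v₂ v₃ (twinLayout-InΔ d₁) (twinLayout-InΔ d₂) (twinLayout-InΔ d₃)))

-- Linear layouts from orderings

module LayoutOf {N : ℕ} (G : Graph N) (ℓ : List (Fin N)) (unique : Unique ℓ) (complete : ∀ x → x ∈ ℓ) where

  position : Fin N → Fin (length ℓ)
  position x = index (complete x)

  lookup-position : ∀ x → lookup ℓ (position x) ≡ x
  lookup-position x = sym (lookup-index (complete x))

  position-lookup : ∀ p → position (lookup ℓ p) ≡ p
  position-lookup p = lookup-injective unique _ _ (lookup-position (lookup ℓ p))

  length≡ : length ℓ ≡ N
  length≡ = ≤-antisym (injective⇒≤ (λ {p} {q} → lookup-injective unique p q))
                      (injective⇒≤ (λ {x} {y} e → trans (sym (lookup-position x)) (trans (cong (lookup ℓ) e) (lookup-position y))))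

  layout : Layout N
  layout = permutation (lookup ℓ ∘ cast (sym length≡)) (cast length≡ ∘ position)
    (λ x → trans (cong (lookup ℓ) (cast-involutive (sym length≡) length≡ (position x))) (lookup-position x))
    (λ p → trans (cong (cast length≡) (position-lookup (cast (sym length≡) p))) (cast-involutive length≡ (sym length≡) p))

  layout-first : ∀ {x xs} → ℓ ≡ x ∷ xs → ∀ p → toℕ p ≡ 0 → layout ⟨$⟩ʳ p ≡ x
  layout-first ℓ≡ p p≡0 = lookup-head ℓ≡ (cast (sym length≡) p) (trans (toℕ-cast (sym length≡) p) p≡0)

  layout-last : ∀ {x} xs → ℓ ≡ xs ++ [ x ] → ∀ p → toℕ p ≡ pred N → layout ⟨$⟩ʳ p ≡ x
  layout-last xs ℓ≡ p p≡ = lookup-last xs ℓ≡ (cast (sym length≡) p) (begin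
    toℕ (cast (sym length≡) p)  ≡⟨ toℕ-cast (sym length≡) p ⟩
    toℕ p                        ≡⟨ p≡ ⟩
    pred N                       ≡⟨ cong pred (trans (sym length≡) (length-last xs ℓ≡)) ⟩
    length xs                    ∎)
    where open ≡-Reasoning

  prefix-position : ∀ i x → prefix layout i x ≡ (toℕ (position x) <ᵇ i)
  prefix-position i x = cong (_<ᵇ i) (toℕ-cast length≡ (position x))

  position-unique : ∀ {x p} → lookup ℓ p ≡ x → position x ≡ p
  position-unique {x} {p} e = lookup-injective unique _ _ (trans (lookup-position x) (sym e))

  ∈-take⇒prefix : ∀ {i x} → x ∈ take i ℓ → prefix layout i x ≡ true
  ∈-take⇒prefix {i} {x} x∈ with p , p<i , e ← ∈-take⁻ ℓ i x∈ =
    trans (prefix-position i x) (Equivalence.to T-≡ (<⇒<ᵇ (subst (λ q → toℕ q < i) (sym (position-unique e)) p<i)))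

  ∈-drop⇒¬prefix : ∀ {i x} → x ∈ drop i ℓ → prefix layout i x ≡ false
  ∈-drop⇒¬prefix {i} {x} x∈ with p , i≤p , e ← ∈-drop⁻ ℓ i x∈ | prefix layout i x in eq
  ... | false = refl
  ... | true  = contradiction (subst (λ q → i ≤ toℕ q) (sym (position-unique e)) i≤p)
                  (<⇒≱ (<ᵇ⇒< _ _ (Equivalence.from T-≡ (trans (sym (prefix-position i x)) eq))))

  prefix⇒∈-take : ∀ {i x} → prefix layout i x ≡ true → x ∈ take i ℓ
  prefix⇒∈-take {i} {x} e = subst (_∈ take i ℓ) (lookup-position x)
    (∈-take⁺ ℓ (position x) (<ᵇ⇒< _ _ (Equivalence.from T-≡ (trans (sym (prefix-position i x)) e))))

  ¬prefix⇒∈-drop : ∀ {i x} → prefix layout i x ≡ false → x ∈ drop i ℓ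
  ¬prefix⇒∈-drop {i} {x} e = subst (_∈ drop i ℓ) (lookup-position x)
    (∈-drop⁺ ℓ (position x) {i} (≮⇒≥ λ p<i → contradiction (trans (sym (Equivalence.to T-≡ (<⇒<ᵇ p<i))) (trans (sym (prefix-position i x)) e)) λ ()))

  cutRank-bounded : ∀ {w} i r (g : Fin r → Fin N) → IndepRows G (prefix layout i) g →
    CutRank≤ (Graph.adj G) (take i ℓ) (drop i ℓ) w → r ≤ w
  cutRank-bounded i r g (rows∈ , independent) c =
    independent⇒≤ (λ y → prefix layout i y ≡ false) (Graph.adj G ∘ g) (coeff ∘ g) basis
      (λ j y y∉ → factorises (g j) y (prefix⇒∈-take (rows∈ j)) (¬prefix⇒∈-drop {i} y∉)) independent
    where open CutRank≤ c

  hasWidth : ∀ {w v} → Width≤ (Graph.adj G) ℓ w → Width≥ (Graph.adj G) ℓ w v → HasWidth G layout w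
  hasWidth {w} width≤ width≥ = (cut-position , cutRank-at-cut) , bounded
    where
    open Width≥ width≥
    open TriangularCut cut
    front-short : length front < suc N
    front-short = s≤s (subst (length front ≤_) (trans (sym (length-++ front)) (trans (cong length split) length≡))
                         (m≤m+n _ _))
    cut-position : Fin (suc N)
    cut-position = fromℕ< front-short
    take≡front : take (toℕ cut-position) ℓ ≡ front
    take≡front = trans (cong₂ take (toℕ-fromℕ< front-short) (sym split)) (take-length-++ front back)
    drop≡back : drop (toℕ cut-position) ℓ ≡ back
    drop≡back = trans (cong₂ drop (toℕ-fromℕ< front-short) (sym split)) (drop-length-++ front back)
    bounded : ∀ i r → CutRank G (prefix layout (toℕ i)) r → r ≤ w
    bounded i r ((g , independent) , _) = cutRank-bounded (toℕ i) r g independent (width≤ _ _ (take++drop≡id (toℕ i) ℓ))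
    cutRank-at-cut : CutRank G (prefix layout (toℕ cut-position)) w
    cutRank-at-cut =
      ( row
      , (λ i → ∈-take⇒prefix {toℕ cut-position} (subst (row i ∈_) (sym take≡front) (row∈ i)))
      , unitriangular⇒independent _ (Graph.adj G ∘ row) col
          (λ i → ∈-drop⇒¬prefix {toℕ cut-position} (subst (col i ∈_) (sym drop≡back) (col∈ i))) diagonal below-diagonal)
      , (λ r g independent → cutRank-bounded (toℕ cut-position) r g independent (width≤ _ _ (take++drop≡id (toℕ cut-position) ℓ)))

-- Deleting a twin

-- addBack identifies G with G \ w extended by a twin of v (with ε = adj v w) placed last.
module DeletedTwin {n} (G : Graph (suc n)) {v w : Fin (suc n)} (w≢v : w ≢ v) (twin : Twin G v w) where

  v′ : Fin n
  v′ = punchOut w≢v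

  addBack : Maybe (Fin n) → Fin (suc n)
  addBack (just x) = punchIn w x
  addBack nothing  = w

  remove : Fin (suc n) → Maybe (Fin n)
  remove y with w Fin.≟ y
  ... | yes _   = nothing
  ... | no w≢y  = just (punchOut w≢y)

  remove∘addBack : ∀ a → remove (addBack a) ≡ a
  remove∘addBack nothing with w Fin.≟ w
  ... | yes _   = refl
  ... | no w≢w  = contradiction refl w≢w
  remove∘addBack (just x) with w Fin.≟ punchIn w x
  ... | yes e   = contradiction (sym e) (punchInᵢ≢i w x)
  ... | no _    = cong just (trans (punchOut-cong w refl) (punchOut-punchIn w))

  addBack∘remove : ∀ y → addBack (remove y) ≡ y
  addBack∘remove y with w Fin.≟ y
  ... | yes w≡y = w≡y
  ... | no w≢y  = punchIn-punchOut w≢y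

  twin′ : Maybe (Fin n) → Maybe (Fin n) → Bool
  twin′ = addTwin (Graph.adj (delete G w)) Fin._≟_ (Graph.adj G v w) v′

  preserves-with-w : ∀ x → Graph.adj G (punchIn w x) w ≡ twin′ (just x) nothing
  preserves-with-w x with x Fin.≟ v′
  ... | yes refl = cong (λ z → Graph.adj G z w) (punchIn-punchOut w≢v)
  ... | no x≢v′  = trans (sym (twin (punchIn w x) punchIn≢v (punchInᵢ≢i w x)))
                         (cong (Graph.adj G (punchIn w x)) (sym (punchIn-punchOut w≢v)))
    where punchIn≢v = λ e → x≢v′ (punchIn-injective w x v′ (trans e (sym (punchIn-punchOut w≢v))))

  preserves : ∀ a b → Graph.adj G (addBack a) (addBack b) ≡ twin′ a b
  preserves (just x) (just y) = refl
  preserves (just x) nothing  = preserves-with-w x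
  preserves nothing  (just y) = trans (Graph.sym G w (punchIn w y)) (preserves-with-w y)
  preserves nothing  nothing  = Graph.irrefl G w

  module _ {k} (L : TwinLayout k (abstractGraph (delete G w)) v′) where
    open TwinLayout L
    private
      module T = Transport {adj′ = Graph.adj G} addBack remove remove∘addBack preserves

    order : List (Fin (suc n))
    order = map addBack (map just (v′ ∷ rest) ++ [ nothing ])

    unique-order : Unique order
    unique-order = map⁺ T.f-injective (++⁺ (map⁺ just-injective unique) (unique-∷ (λ ()) [])
                                           (λ { (x∈ , here refl) → ∉-map just (λ _ ()) x∈ }))

    complete-order : ∀ y → y ∈ order
    complete-order y = subst (_∈ order) (addBack∘remove y) (∈-map⁺ addBack (complete-Maybe (remove y)))
      where
      complete-Maybe : ∀ a → a ∈ map just (v′ ∷ rest) ++ [ nothing ]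
      complete-Maybe (just x) = ∈-++⁺ˡ (∈-map⁺ just (complete x))
      complete-Maybe nothing  = ∈-++⁺ʳ (map just (v′ ∷ rest)) (here refl)

    width≤-order : Width≤ (Graph.adj G) order (suc k)
    width≤-order = T.width≤ (width≤ (Graph.adj G v w))

    width≥-order : Width≥ (Graph.adj G) order (suc k) (addBack (just v′))
    width≥-order = T.width≥ (width≥-addTwin width≥)

lemma3p3 : (k : ℕ) {n : ℕ} (G : Graph (suc n)) (v w : Fin (suc n)) →
    w ≢ v → Twin G v w → InΔ k (delete G w) →
    Σ (Layout (suc n)) λ L → HasWidth G L (suc k) × firstV L ≡ v × lastV L ≡ w
lemma3p3 k {n} G v w w≢v twin inΔ = layout , hasWidth (width≤-order L) (width≥-order L) , first , last
  where
  open DeletedTwin G w≢v twin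
  L : TwinLayout k (abstractGraph (delete G w)) v′
  L = twinLayout-InΔ inΔ v′
  open TwinLayout L using (rest)
  open LayoutOf G (order L) (unique-order L) (complete-order L)
  first : firstV layout ≡ v
  first = trans (layout-first refl zero refl) (punchIn-punchOut w≢v)
  last : lastV layout ≡ w
  last = layout-last (map addBack (map just (v′ ∷ rest))) (map-++ addBack (map just (v′ ∷ rest)) [ nothing ]) (fromℕ n) (toℕ-fromℕ n)
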